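{- Let $U$ be a $2$-cuttable unrooted binary phylogenetic network on $X$. Then the reticulation number of $U$ is at most $|X|-1$.
   Context: An unrooted binary phylogenetic network on a non-empty finite set $X$ is a simple connected undirected graph whose internal vertices have degree $3$ and whose degree-$1$ vertices (leaves) are bijectively labeled by $X$. A cut-edge is an edge whose deletion disconnects the graph. $U$ is $2$-cuttable if every cycle contains a path of at least $2$ vertices each incident to a cut-edge. The reticulation number of $U$ with vertex set $V$ and edge set $E$ is $|E|-(|V|-1)$. -}

module Defs where

open import Data.Bool using (Bool; true; false; _∧_; _∨_; not)
open import Data.Nat using (ℕ; zero; suc; _<ᵇ_; _≡ᵇ_; _≤_)
open import Data.Nat.DivMod using (_%_; m%n<n)
open import Data.Fin using (Fin; toℕ; fromℕ<; _≟_)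
open import Data.List using (List; length; filterᵇ; allFin; cartesianProduct)
open import Data.Product using (_×_; _,_; ∃; Σ)
open import Relation.Nullary using (¬_)
open import Relation.Nullary.Decidable using (⌊_⌋)
open import Relation.Binary.PropositionalEquality using (_≡_)
open import Function.Definitions using (Injective)
open import Data.Integer as ℤ using (ℤ; +_)

record Graph : Set where
  field
    n   : ℕ
    adj : Fin n → Fin n → Bool
    sym : ∀ u v → adj u v ≡ adj v u
    irr : ∀ u → adj u u ≡ false
open Graph public

degree : (G : Graph) → Fin (n G) → ℕ
degree G v = length (filterᵇ (adj G v) (allFin (n G)))

numV : Graph → ℕ
numV G = n G

numE : Graph → ℕ
numE G = length (filterᵇ (λ p → (toℕ (Data.Product.proj₁ p) <ᵇ toℕ (Data.Product.proj₂ p))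
                                 ∧ adj G (Data.Product.proj₁ p) (Data.Product.proj₂ p))
                         (cartesianProduct (allFin (n G)) (allFin (n G))))

data Reach {m : ℕ} (a : Fin m → Fin m → Bool) : Fin m → Fin m → Set where
  here : ∀ {u} → Reach a u u
  step : ∀ {u v w} → a u v ≡ true → Reach a v w → Reach a u w

Connected' : {m : ℕ} → (Fin m → Fin m → Bool) → Set
Connected' a = ∀ u v → Reach a u v

Connected : Graph → Set
Connected G = Connected' (adj G)

deleteEdge : (G : Graph) → Fin (n G) → Fin (n G) → Fin (n G) → Fin (n G) → Bool
deleteEdge G u v x y =
  adj G x y ∧ not ((⌊ x ≟ u ⌋ ∧ ⌊ y ≟ v ⌋) ∨ (⌊ x ≟ v ⌋ ∧ ⌊ y ≟ u ⌋))

IsCutEdge : (G : Graph) → Fin (n G) → Fin (n G) → Set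
IsCutEdge G u v = adj G u v ≡ true × ¬ Connected' (deleteEdge G u v)

IncidentToCutEdge : (G : Graph) → Fin (n G) → Set
IncidentToCutEdge G v = ∃ λ w → IsCutEdge G v w

next : {k : ℕ} → Fin (suc k) → Fin (suc k)
next {k} i = fromℕ< (m%n<n (suc (toℕ i)) (suc k))

record Cycle (G : Graph) : Set where
  field
    k     : ℕ
    c     : Fin (suc (suc (suc k))) → Fin (n G)
    inj   : Injective _≡_ _≡_ c
    edges : ∀ i → adj G (c i) (c (next i)) ≡ true
open Cycle public

-- the cycle contains a path of at least 2 vertices each incident to a
-- cut-edge; equivalently (subpaths of a path are paths) two cyclically
-- consecutive cycle vertices both incident to a cut-edge
TwoCuttable : Graph → Set
TwoCuttable G = (C : Cycle G) →
  ∃ λ i → IncidentToCutEdge G (c C i) × IncidentToCutEdge G (c C (next i))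

-- unrooted binary phylogenetic network on X = Fin m (m ≥ 1):
-- connected simple graph, every degree-1 vertex (leaf) is labelled by a
-- bijection Fin m ≅ leaves, every other vertex has degree 3
record UBPN (m : ℕ) : Set where
  field
    graph     : Graph
    nonEmpty  : 1 ≤ m
    connected : Connected graph
    internal  : ∀ v → ¬ (degree graph v ≡ 1) → degree graph v ≡ 3
    label     : Fin m → Fin (n graph)
    labelLeaf : ∀ x → degree graph (label x) ≡ 1
    labelInj  : Injective _≡_ _≡_ label
    labelSurj : ∀ v → degree graph v ≡ 1 → ∃ λ x → label x ≡ v
open UBPN public

reticulationNumber : Graph → ℤ
reticulationNumber G = + numE G ℤ.- (+ numV G ℤ.- + 1)

{-# OPTIONS --safe #-}
-- Write L and I for the numbers of leaves and of internal (degree-3) vertices. Then 2|E| = L + 3I,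
-- |V| = L + I and L ≤ |X|, so it suffices to show I + 4 ≤ 3L. We prove I + 6 ≤ 3L, which, unlike the
-- former, is additive under cutting the network at a bridge between two internal vertices (each half
-- gains one leaf); so it suffices to treat networks whose bridges all end in leaves. In such a network
-- either an internal vertex carries two leaves, and the network is a star with three leaves, or every
-- internal vertex carries at most one. In the latter case the edges between internal vertices that do
-- not join two leaf-carrying vertices form a forest, since 2-cuttability puts an edge between two
-- leaf-carrying vertices on every cycle; counting degrees in this forest, together with a parity
-- argument, gives the bound.

module Submission where

open import Defs hiding (sym)
open import Data.Nat using (ℕ)

-- ℕ's order is only opened inside this module, since the theorem at the end uses ℤ's _≤_.
module _ where
  open import Data.Bool using (Bool; true; false; _∧_; _∨_; not; T)
  open import Data.Bool.Properties using (∧-conicalˡ; ∧-conicalʳ; ¬-not)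
  import Data.Bool.Properties as Bool
  open import Data.Empty using (⊥)
  open import Data.Fin using (Fin; zero; suc; _≟_; toℕ; fromℕ<)
  open import Data.Fin.Properties using (any?; toℕ-injective; toℕ<n; toℕ-fromℕ<; pigeonhole; injective⇒≤)
  open import Data.List using (List; []; _∷_; _++_; map; length; tabulate; filterᵇ; cartesianProduct)
  open import Data.List.Properties using (length-++; filter-++; map-tabulate; length-tabulate)
  open import Data.List.Membership.Propositional using (_∈_)
  open import Data.List.Membership.Propositional.Properties using (∈-tabulate⁺)
  open import Data.List.Relation.Unary.All as All using (All; []; _∷_)
  open import Data.List.Relation.Unary.All.Properties using (¬Any⇒All¬)
  open import Data.List.Relation.Unary.Any as Any using (here; there)
  open import Data.List.Relation.Unary.Unique.Propositional using (Unique; []; _∷_)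
  import Data.Nat as ℕ
  open import Data.Nat using (zero; suc; _+_; _*_; _≤_; _<_; _<ᵇ_; _<?_; z≤n; s≤s)
  open import Data.Nat.DivMod using (_%_; m<n⇒m%n≡m; n%n≡0)
  open import Data.Nat.Induction using (<-rec)
  open import Data.Nat.Properties hiding (_≟_)
  open import Algebra.Properties.CommutativeMonoid.Sum +-0-commutativeMonoid
    using (sum; sum-cong-≗; ∑-distrib-+; ∑-comm; sum-replicate-zero)
  open import Data.Nat.Tactic.RingSolver using (solve-∀)
  open import Data.Product using (_×_; _,_; ∃; ∃₂; proj₁; proj₂; map₂)
  import Data.Product as Product
  open import Data.Sum using (_⊎_; inj₁; inj₂; [_,_]′)
  import Data.Sum as Sum
  open import Function using (_∘_; id; Equivalence)
  open import Relation.Binary using (tri<; tri≈; tri>)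
  open import Relation.Binary.PropositionalEquality
    using (_≡_; _≢_; refl; sym; trans; cong; cong₂; subst; subst₂; module ≡-Reasoning)
  open import Relation.Nullary using (¬_; ¬?; Dec; yes; no; contradiction)
  open import Relation.Nullary.Decidable
    using (⌊_⌋; ⌊⌋-map′; T?; toSum; _×-dec_; _⊎-dec_; decidable-stable; ¬¬-excluded-middle)
  open import Relation.Unary using (Decidable)

  -- Counting

  ⌊⌋-yes : ∀ {A : Set} (a? : Dec A) → A → ⌊ a? ⌋ ≡ true
  ⌊⌋-yes (yes _) _ = refl
  ⌊⌋-yes (no ¬a) a = contradiction a ¬a

  ⌊⌋-no : ∀ {A : Set} (a? : Dec A) → ¬ A → ⌊ a? ⌋ ≡ false
  ⌊⌋-no (yes a) ¬a = contradiction a ¬a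
  ⌊⌋-no (no _)  _  = refl

  ⌊⌋-sound : ∀ {A : Set} (a? : Dec A) → ⌊ a? ⌋ ≡ true → A
  ⌊⌋-sound (yes a) _ = a

  false≢true : false ≢ true
  false≢true ()

  bool-cases : ∀ {P : Set} b → (b ≡ true → P) → (b ≡ false → P) → P
  bool-cases true  t f = t refl
  bool-cases false t f = f refl

  𝟙 : Bool → ℕ
  𝟙 true  = 1
  𝟙 false = 0

  𝟙≤1 : ∀ b → 𝟙 b ≤ 1
  𝟙≤1 true  = ≤-refl
  𝟙≤1 false = z≤n

  [_≡_] : ℕ → ℕ → ℕ
  [ d ≡ k ] = 𝟙 ⌊ d ℕ.≟ k ⌋

  count : ∀ {n} → (Fin n → Bool) → ℕ
  count p = sum (𝟙 ∘ p)

  sum-zero : ∀ {n} {f : Fin n → ℕ} → (∀ i → f i ≡ 0) → sum f ≡ 0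
  sum-zero {n} f≡0 = trans (sum-cong-≗ f≡0) (sum-replicate-zero n)

  count-true : ∀ n → count {n} (λ _ → true) ≡ n
  count-true zero    = refl
  count-true (suc n) = cong suc (count-true n)

  sum-mono : ∀ {n} {f g : Fin n → ℕ} → (∀ i → f i ≤ g i) → sum f ≤ sum g
  sum-mono {zero}  f≤g = z≤n
  sum-mono {suc n} f≤g = +-mono-≤ (f≤g zero) (sum-mono (f≤g ∘ suc))

  term≤sum : ∀ {n} (f : Fin n → ℕ) i → f i ≤ sum f
  term≤sum f zero    = m≤m+n _ _
  term≤sum f (suc i) = ≤-trans (term≤sum (f ∘ suc) i) (m≤n+m _ _)

  𝟙-split : ∀ a b → 𝟙 a ≡ 𝟙 (a ∧ b) + 𝟙 (a ∧ not b)
  𝟙-split true  true  = refl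
  𝟙-split true  false = refl
  𝟙-split false b     = refl

  count-split : ∀ {n} (p q : Fin n → Bool) →
                count p ≡ count (λ i → p i ∧ q i) + count (λ i → p i ∧ not (q i))
  count-split p q = trans (sum-cong-≗ (λ i → 𝟙-split (p i) (q i)))
                          (∑-distrib-+ (λ i → 𝟙 (p i ∧ q i)) (λ i → 𝟙 (p i ∧ not (q i))))

  count-mono : ∀ {n} {p q : Fin n → Bool} → (∀ i → p i ≡ true → q i ≡ true) → count p ≤ count q
  count-mono {p = p} {q} p⇒q = sum-mono pointwise
    where
    pointwise : ∀ i → 𝟙 (p i) ≤ 𝟙 (q i)
    pointwise i with p i | p⇒q i
    ... | false | _   = z≤n
    ... | true  | q-true rewrite q-true refl = ≤-refl

  count-pos : ∀ {n} (p : Fin n → Bool) {i} → p i ≡ true → 1 ≤ count p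
  count-pos p {i} pi = subst (λ b → 𝟙 b ≤ count p) pi (term≤sum (𝟙 ∘ p) i)

  -- ⌊_⌋ is strict, so ⌊ suc i ≟ suc x ⌋ and ⌊ i ≟ x ⌋ are only propositionally equal
  count-singleton : ∀ {n} (x : Fin n) → count (λ i → ⌊ i ≟ x ⌋) ≡ 1
  count-singleton {suc n} zero    = cong suc (sum-replicate-zero n)
  count-singleton {suc n} (suc x) = trans (sum-cong-≗ (λ i → cong 𝟙 (⌊⌋-map′ _ _ (i ≟ x)))) (count-singleton x)

  count≤length : ∀ {n} {p : Fin n → Bool} xs → (∀ i → p i ≡ true → i ∈ xs) → count p ≤ length xs
  count≤length [] covered = ≤-reflexive (sum-zero (λ i → cong 𝟙 (¬-not (λ pi → contradiction (covered i pi) λ ()))))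
  count≤length {p = p} (x ∷ xs) covered = begin
    count p                                                 ≡⟨ count-split p (λ i → ⌊ i ≟ x ⌋) ⟩
    count (λ i → p i ∧ ⌊ i ≟ x ⌋) + count (λ i → p i ∧ not ⌊ i ≟ x ⌋)
      ≤⟨ +-mono-≤ (≤-trans (count-mono (λ i → ∧-conicalʳ (p i) _)) (≤-reflexive (count-singleton x)))
                  (count≤length xs rest) ⟩
    suc (length xs)                                         ∎
    where
    open ≤-Reasoning
    rest : ∀ i → p i ∧ not ⌊ i ≟ x ⌋ ≡ true → i ∈ xs
    rest i pi with covered i (∧-conicalˡ (p i) _ pi) | i ≟ x | ∧-conicalʳ (p i) _ pi
    ... | here i≡x  | no i≢x | _ = contradiction i≡x i≢x
    ... | there i∈xs | _     | _ = i∈xs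

  length≤count : ∀ {n} {p : Fin n → Bool} {xs} → Unique xs → All (λ i → p i ≡ true) xs → length xs ≤ count p
  length≤count []                    []        = z≤n
  length≤count {p = p} {x ∷ xs} (x∉xs ∷ xs!) (px ∷ pxs) = begin
    suc (length xs)
      ≤⟨ +-mono-≤ (count-pos (λ i → p i ∧ ⌊ i ≟ x ⌋) (cong₂ _∧_ px (⌊⌋-yes (x ≟ x) refl)))
                  (length≤count xs! (All.zipWith others (pxs , x∉xs))) ⟩
    count (λ i → p i ∧ ⌊ i ≟ x ⌋) + count (λ i → p i ∧ not ⌊ i ≟ x ⌋)  ≡⟨ count-split p (λ i → ⌊ i ≟ x ⌋) ⟨
    count p ∎
    where
    open ≤-Reasoning
    others : ∀ {i} → p i ≡ true × x ≢ i → p i ∧ not ⌊ i ≟ x ⌋ ≡ true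
    others {i} (pi , x≢i) = cong₂ _∧_ pi (cong not (⌊⌋-no (i ≟ x) (x≢i ∘ sym)))

  count-witness : ∀ {n} (p : Fin n → Bool) → 1 ≤ count p → ∃ λ i → p i ≡ true
  count-witness p 1≤count with any? (λ i → p i Bool.≟ true)
  ... | yes found = found
  ... | no none   = contradiction (count≤length [] (λ i pi → contradiction (i , pi) none)) (<⇒≱ 1≤count)

  count-witness₂ : ∀ {n} (p : Fin n → Bool) → 2 ≤ count p → ∃₂ λ i j → i ≢ j × p i ≡ true × p j ≡ true
  count-witness₂ p 2≤count with count-witness p (≤-trans (s≤s z≤n) 2≤count)
  ... | i , pi with any? (λ j → (p j Bool.≟ true) ×-dec ¬? (i ≟ j))
  ...   | yes (j , pj , i≢j) = i , j , i≢j , pi , pj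
  ...   | no none = contradiction (count≤length (i ∷ []) only-i) (<⇒≱ 2≤count)
    where
    only-i : ∀ j → p j ≡ true → j ∈ i ∷ []
    only-i j pj with i ≟ j
    ... | yes i≡j = here (sym i≡j)
    ... | no i≢j  = contradiction (j , pj , i≢j) none

  count≥2 : ∀ {n} (p : Fin n → Bool) {i j} → i ≢ j → p i ≡ true → p j ≡ true → 2 ≤ count p
  count≥2 p i≢j pi pj = length≤count ((i≢j ∷ []) ∷ [] ∷ []) (pi ∷ pj ∷ [])

  count-∧-singleton : ∀ {n} b (x : Fin n) → count (λ i → b ∧ ⌊ i ≟ x ⌋) ≡ 𝟙 b
  count-∧-singleton true  x = count-singleton x
  count-∧-singleton false x = sum-zero {f = λ i → 𝟙 (false ∧ ⌊ i ≟ x ⌋)} (λ _ → refl)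


  -- Degrees and the handshake lemma

  length-filterᵇ-tabulate : ∀ {A : Set} {n} (p : A → Bool) (f : Fin n → A) →
                            length (filterᵇ p (tabulate f)) ≡ count (p ∘ f)
  length-filterᵇ-tabulate {n = zero}  p f = refl
  length-filterᵇ-tabulate {n = suc n} p f with p (f zero)
  ... | true  = cong suc (length-filterᵇ-tabulate p (f ∘ suc))
  ... | false = length-filterᵇ-tabulate p (f ∘ suc)

  length-filterᵇ-cartesianProduct : ∀ {A B : Set} {m n} (p : A × B → Bool) (f : Fin m → A) (g : Fin n → B) →
    length (filterᵇ p (cartesianProduct (tabulate f) (tabulate g))) ≡ sum (λ i → count (λ j → p (f i , g j)))
  length-filterᵇ-cartesianProduct {m = zero}  p f g = refl
  length-filterᵇ-cartesianProduct {m = suc m} p f g = begin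
    length (filterᵇ p (row ++ rest))                      ≡⟨ cong length (filter-++ (T? ∘ p) row rest) ⟩
    length (filterᵇ p row ++ filterᵇ p rest)              ≡⟨ length-++ (filterᵇ p row) ⟩
    length (filterᵇ p row) + length (filterᵇ p rest)
      ≡⟨ cong₂ _+_ (trans (cong (length ∘ filterᵇ p) (map-tabulate g (f zero ,_)))
                          (length-filterᵇ-tabulate p (λ j → f zero , g j)))
                   (length-filterᵇ-cartesianProduct p (f ∘ suc) g) ⟩
    count (λ j → p (f zero , g j)) + sum (λ i → count (λ j → p (f (suc i) , g j)))  ∎
    where
    open ≡-Reasoning
    row  = map (f zero ,_) (tabulate g)
    rest = cartesianProduct (tabulate (f ∘ suc)) (tabulate g)

  degree≡count : ∀ G v → degree G v ≡ count (adj G v)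
  degree≡count G v = length-filterᵇ-tabulate (adj G v) id

  _≺ᵇ_ : ∀ {n} → Fin n → Fin n → Bool
  u ≺ᵇ v = toℕ u <ᵇ toℕ v

  numE≡sum : ∀ G → numE G ≡ sum (λ u → count (λ v → u ≺ᵇ v ∧ adj G u v))
  numE≡sum G = length-filterᵇ-cartesianProduct (λ (u , v) → u ≺ᵇ v ∧ adj G u v) id id

  ≺ᵇ-sound : ∀ {n} {u v : Fin n} → u ≺ᵇ v ≡ true → toℕ u < toℕ v
  ≺ᵇ-sound {u = u} {v} eq = <ᵇ⇒< (toℕ u) (toℕ v) (Equivalence.from Bool.T-≡ eq)

  ≺ᵇ-false : ∀ {n} {u v : Fin n} → u ≺ᵇ v ≡ false → toℕ v ≤ toℕ u
  ≺ᵇ-false {u = u} {v} eq = ≮⇒≥ (λ u<v → subst T eq (<⇒<ᵇ u<v))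

  𝟙-adj-split : ∀ G u v → 𝟙 (adj G u v) ≡ 𝟙 (u ≺ᵇ v ∧ adj G u v) + 𝟙 (v ≺ᵇ u ∧ adj G v u)
  𝟙-adj-split G u v rewrite Graph.sym G v u with u ≺ᵇ v in u≺v | v ≺ᵇ u in v≺u
  ... | true  | true  = contradiction (≺ᵇ-sound {u = u} u≺v) (<⇒≯ (≺ᵇ-sound {u = v} v≺u))
  ... | true  | false = sym (+-identityʳ _)
  ... | false | true  = refl
  ... | false | false = cong 𝟙 (subst (λ w → adj G w v ≡ false) (sym u≡v) (irr G v))
    where
    u≡v : u ≡ v
    u≡v = toℕ-injective (≤-antisym (≺ᵇ-false {u = v} v≺u) (≺ᵇ-false {u = u} u≺v))

  handshake : ∀ G → sum (degree G) ≡ numE G + numE G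
  handshake G = begin
    sum (degree G)                                        ≡⟨ sum-cong-≗ (degree≡count G) ⟩
    sum (λ u → count (adj G u))                           ≡⟨ sum-cong-≗ (λ u → sum-cong-≗ (𝟙-adj-split G u)) ⟩
    sum (λ u → sum (λ v → forward u v + forward v u))     ≡⟨ sum-cong-≗ (λ u → ∑-distrib-+ (forward u) (λ v → forward v u)) ⟩
    sum (λ u → sum (forward u) + sum (λ v → forward v u)) ≡⟨ ∑-distrib-+ (sum ∘ forward) (λ u → sum (λ v → forward v u)) ⟩
    sum (sum ∘ forward) + sum (λ u → sum (λ v → forward v u))
                                                          ≡⟨ cong (sum (sum ∘ forward) +_) (∑-comm (λ u v → forward v u)) ⟩
    sum (sum ∘ forward) + sum (sum ∘ forward)             ≡⟨ cong₂ _+_ (numE≡sum G) (numE≡sum G) ⟨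
    numE G + numE G                                       ∎
    where
    open ≡-Reasoning
    forward : Fin (n G) → Fin (n G) → ℕ
    forward u v = 𝟙 (u ≺ᵇ v ∧ adj G u v)


  -- Reachability, subgraphs and bridges

  adjacent⇒distinct : ∀ G {x y} → adj G x y ≡ true → x ≢ y
  adjacent⇒distinct G {x} xy refl = false≢true (trans (sym (irr G x)) xy)

  Reach-snoc : ∀ {m} {a : Fin m → Fin m → Bool} {x y z} → Reach a x y → a y z ≡ true → Reach a x z
  Reach-snoc here       e = step e here
  Reach-snoc (step e r) f = step e (Reach-snoc r f)

  Reach-trans : ∀ {m} {a : Fin m → Fin m → Bool} {x y z} → Reach a x y → Reach a y z → Reach a x z
  Reach-trans here       r = r
  Reach-trans (step e r) s = step e (Reach-trans r s)

  Reach-sym : ∀ {m} {a : Fin m → Fin m → Bool} → (∀ u v → a u v ≡ a v u) → ∀ {x y} → Reach a x y → Reach a y x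
  Reach-sym a-sym here                   = here
  Reach-sym a-sym (step {u} {v} e r) = Reach-snoc (Reach-sym a-sym r) (trans (a-sym v u) e)

  Reach-map : ∀ {m} {a b : Fin m → Fin m → Bool} → (∀ u v → a u v ≡ true → b u v ≡ true) →
              ∀ {x y} → Reach a x y → Reach b x y
  Reach-map a⇒b here       = here
  Reach-map a⇒b (step e r) = step (a⇒b _ _ e) (Reach-map a⇒b r)

  Closed : ∀ {m} → (Fin m → Fin m → Bool) → (Fin m → Set) → Set
  Closed a S = ∀ {u v} → S u → a u v ≡ true → S v

  Reach-closed : ∀ {m} {a : Fin m → Fin m → Bool} {S : Fin m → Set} → Closed a S →
                 ∀ {x y} → Reach a x y → S x → S y
  Reach-closed closed here       sx = sx
  Reach-closed closed (step e r) sx = Reach-closed closed r (closed sx e)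

  Reach-within : ∀ {m} {a b : Fin m → Fin m → Bool} {S : Fin m → Set} → Closed a S →
                 (∀ {u v} → S u → S v → a u v ≡ true → b u v ≡ true) →
                 ∀ {x y} → Reach a x y → S x → Reach b x y
  Reach-within closed a⇒b here       sx = here
  Reach-within closed a⇒b (step e r) sx = step (a⇒b sx (closed sx e) e) (Reach-within closed a⇒b r (closed sx e))

  subgraph : (G : Graph) (keep : Fin (n G) → Fin (n G) → Bool) → (∀ x y → keep x y ≡ keep y x) → Graph
  subgraph G keep keep-sym = record
    { n   = n G
    ; adj = λ x y → adj G x y ∧ keep x y
    ; sym = λ x y → cong₂ _∧_ (Graph.sym G x y) (keep-sym x y)
    ; irr = λ x → cong (_∧ keep x x) (irr G x)
    }

  module _ {G : Graph} {keep : Fin (n G) → Fin (n G) → Bool} {keep-sym : ∀ x y → keep x y ≡ keep y x} where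

    private
      H = subgraph G keep keep-sym

    subgraph-edge : ∀ {x y} → adj H x y ≡ true → adj G x y ≡ true
    subgraph-edge {x} {y} = ∧-conicalˡ (adj G x y) (keep x y)

    subgraph-cycle : Cycle H → Cycle G
    subgraph-cycle C = record { k = k C ; c = c C ; inj = inj C ; edges = subgraph-edge ∘ edges C }

  induced : (G : Graph) → (Fin (n G) → Bool) → Graph
  induced G M = subgraph G (λ x y → M x ∧ M y) (λ x y → Bool.∧-comm (M x) (M y))

  module _ (G : Graph) (M : Fin (n G) → Bool) {x : Fin (n G)} where

    induced-degree-all : M x ≡ true → (∀ {y} → adj G x y ≡ true → M y ≡ true) → degree (induced G M) x ≡ degree G x
    induced-degree-all Mx closed = trans (degree≡count (induced G M) x) (trans (sum-cong-≗ pointwise) (sym (degree≡count G x)))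
      where
      pointwise : ∀ y → 𝟙 (adj G x y ∧ (M x ∧ M y)) ≡ 𝟙 (adj G x y)
      pointwise y with adj G x y in xy
      ... | true  rewrite Mx | closed xy = refl
      ... | false = refl

    induced-degree-none : M x ≡ false → degree (induced G M) x ≡ 0
    induced-degree-none Mx = trans (degree≡count (induced G M) x) (sum-zero pointwise)
      where
      pointwise : ∀ y → 𝟙 (adj G x y ∧ (M x ∧ M y)) ≡ 0
      pointwise y rewrite Mx = cong 𝟙 (Bool.∧-zeroʳ (adj G x y))

    induced-degree-one : ∀ {p} → M x ≡ true → adj G x p ≡ true → M p ≡ true →
                         (∀ {y} → adj G x y ≡ true → M y ≡ true → y ≡ p) → degree (induced G M) x ≡ 1
    induced-degree-one {p} Mx xp Mp only-p = trans (degree≡count (induced G M) x)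
      (≤-antisym (count≤length (p ∷ []) (λ y e → here (only-p (∧-conicalˡ (adj G x y) _ e) (My e))))
                 (count-pos (λ y → adj G x y ∧ (M x ∧ M y)) (cong₂ _∧_ xp (cong₂ _∧_ Mx Mp))))
      where
      My : ∀ {y} → adj G x y ∧ (M x ∧ M y) ≡ true → M y ≡ true
      My {y} e = ∧-conicalʳ (M x) (M y) (∧-conicalʳ (adj G x y) _ e)

  SameEdge : ∀ {m} → Fin m → Fin m → Fin m → Fin m → Set
  SameEdge u v x y = (x ≡ u × y ≡ v) ⊎ (x ≡ v × y ≡ u)

  sameEdge? : ∀ {m} (u v x y : Fin m) → Dec (SameEdge u v x y)
  sameEdge? u v x y = ((x ≟ u) ×-dec (y ≟ v)) ⊎-dec ((x ≟ v) ×-dec (y ≟ u))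

  module _ (G : Graph) (u v : Fin (n G)) where

    private
      isUV : Fin (n G) → Fin (n G) → Bool
      isUV x y = (⌊ x ≟ u ⌋ ∧ ⌊ y ≟ v ⌋) ∨ (⌊ x ≟ v ⌋ ∧ ⌊ y ≟ u ⌋)

      isUV-sym : ∀ x y → not (isUV x y) ≡ not (isUV y x)
      isUV-sym x y = cong not (trans (cong₂ _∨_ (Bool.∧-comm ⌊ x ≟ u ⌋ _) (Bool.∧-comm ⌊ x ≟ v ⌋ _))
                                     (Bool.∨-comm (⌊ y ≟ v ⌋ ∧ ⌊ x ≟ u ⌋) _))

    withoutEdge : Graph
    withoutEdge = subgraph G (λ x y → not (isUV x y)) isUV-sym

    deleteEdge-edge : ∀ {x y} → deleteEdge G u v x y ≡ true → adj G x y ≡ true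
    deleteEdge-edge {x} {y} = ∧-conicalˡ (adj G x y) _

    deleteEdge-keeps : ∀ {x y} → adj G x y ≡ true → ¬ SameEdge u v x y → deleteEdge G u v x y ≡ true
    deleteEdge-keeps {x} {y} xy ¬uv rewrite xy with x ≟ u | y ≟ v | x ≟ v | y ≟ u
    ... | yes x≡u | yes y≡v | _       | _       = contradiction (inj₁ (x≡u , y≡v)) ¬uv
    ... | _       | _       | yes x≡v | yes y≡u = contradiction (inj₂ (x≡v , y≡u)) ¬uv
    ... | no _    | _       | no _    | _       = refl
    ... | no _    | _       | yes _   | no _    = refl
    ... | yes _   | no _    | no _    | _       = refl
    ... | yes _   | no _    | yes _   | no _    = refl

    deleteEdge-drops : ∀ {x y} → SameEdge u v x y → deleteEdge G u v x y ≡ false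
    deleteEdge-drops {x} {y} (inj₁ (refl , refl)) rewrite ⌊⌋-yes (x ≟ x) refl | ⌊⌋-yes (y ≟ y) refl =
      Bool.∧-zeroʳ (adj G x y)
    deleteEdge-drops {x} {y} (inj₂ (refl , refl)) rewrite ⌊⌋-yes (x ≟ x) refl | ⌊⌋-yes (y ≟ y) refl
                                                        | Bool.∨-zeroʳ (⌊ x ≟ y ⌋ ∧ ⌊ y ≟ x ⌋) =
      Bool.∧-zeroʳ (adj G x y)

  module _ (G : Graph) {u v : Fin (n G)} (uv : adj G u v ≡ true) where

    private
      u≢v : u ≢ v
      u≢v = adjacent⇒distinct G uv

      kept : ∀ a → 𝟙 a ≡ 𝟙 (a ∧ true) + 0
      kept true  = refl
      kept false = refl

    𝟙-adj-withoutEdge : ∀ z w → 𝟙 (adj G z w) ≡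
      𝟙 (deleteEdge G u v z w) + (𝟙 (⌊ z ≟ u ⌋ ∧ ⌊ w ≟ v ⌋) + 𝟙 (⌊ z ≟ v ⌋ ∧ ⌊ w ≟ u ⌋))
    𝟙-adj-withoutEdge z w with z ≟ u | w ≟ v | z ≟ v | w ≟ u
    ... | yes refl | _        | yes refl | _        = contradiction refl u≢v
    ... | _        | yes refl | _        | yes refl = contradiction refl u≢v
    ... | yes refl | yes refl | no _     | no _     rewrite uv = refl
    ... | no _     | no _     | yes refl | yes refl rewrite Graph.sym G v u | uv = refl
    ... | yes _    | no _     | no _     | _        = kept (adj G z w)
    ... | no _     | _        | no _     | _        = kept (adj G z w)
    ... | no _     | _        | yes _    | no _     = kept (adj G z w)

    degree-withoutEdge : ∀ z → degree G z ≡ degree (withoutEdge G u v) z + (𝟙 ⌊ z ≟ u ⌋ + 𝟙 ⌊ z ≟ v ⌋)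
    degree-withoutEdge z = begin
      degree G z                                                  ≡⟨ degree≡count G z ⟩
      sum (𝟙 ∘ adj G z)                                           ≡⟨ sum-cong-≗ (𝟙-adj-withoutEdge z) ⟩
      sum (λ w → 𝟙 (deleteEdge G u v z w) + (zu w + zv w))
        ≡⟨ ∑-distrib-+ (𝟙 ∘ deleteEdge G u v z) (λ w → zu w + zv w) ⟩
      count (deleteEdge G u v z) + sum (λ w → zu w + zv w)        ≡⟨ cong₂ _+_ (sym (degree≡count (withoutEdge G u v) z))
                                                                            (∑-distrib-+ zu zv) ⟩
      degree (withoutEdge G u v) z + (sum zu + sum zv)
        ≡⟨ cong (degree (withoutEdge G u v) z +_)
                (cong₂ _+_ (count-∧-singleton ⌊ z ≟ u ⌋ v) (count-∧-singleton ⌊ z ≟ v ⌋ u)) ⟩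
      degree (withoutEdge G u v) z + (𝟙 ⌊ z ≟ u ⌋ + 𝟙 ⌊ z ≟ v ⌋)  ∎
      where
      open ≡-Reasoning
      zu zv : Fin (n G) → ℕ
      zu w = 𝟙 (⌊ z ≟ u ⌋ ∧ ⌊ w ≟ v ⌋)
      zv w = 𝟙 (⌊ z ≟ v ⌋ ∧ ⌊ w ≟ u ⌋)

    sum-degree-withoutEdge : sum (degree G) ≡ sum (degree (withoutEdge G u v)) + 2
    sum-degree-withoutEdge = begin
      sum (degree G)                                    ≡⟨ sum-cong-≗ degree-withoutEdge ⟩
      sum (λ z → degree G′ z + (𝟙 ⌊ z ≟ u ⌋ + 𝟙 ⌊ z ≟ v ⌋))
        ≡⟨ ∑-distrib-+ (degree G′) (λ z → 𝟙 ⌊ z ≟ u ⌋ + 𝟙 ⌊ z ≟ v ⌋) ⟩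
      sum (degree G′) + sum (λ z → 𝟙 ⌊ z ≟ u ⌋ + 𝟙 ⌊ z ≟ v ⌋)
        ≡⟨ cong (sum (degree G′) +_) (trans (∑-distrib-+ (λ z → 𝟙 ⌊ z ≟ u ⌋) (λ z → 𝟙 ⌊ z ≟ v ⌋))
                                              (cong₂ _+_ (count-singleton u) (count-singleton v))) ⟩
      sum (degree G′) + 2                               ∎
      where
      open ≡-Reasoning
      G′ = withoutEdge G u v

  IsBridge : (G : Graph) → Fin (n G) → Fin (n G) → Set
  IsBridge G u v = adj G u v ≡ true × ¬ Reach (deleteEdge G u v) u v

  IncidentToBridge : (G : Graph) → Fin (n G) → Set
  IncidentToBridge G x = ∃ λ y → IsBridge G x y

  cutEdge⇒bridge : ∀ {G u v} → Connected G → IsCutEdge G u v → IsBridge G u v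
  cutEdge⇒bridge {G} {u} {v} connected (uv , disconnected) =
    uv , λ u⇝v → disconnected (λ a b → reroute u⇝v (connected a b))
    where
    reroute : Reach (deleteEdge G u v) u v → ∀ {a b} → Reach (adj G) a b → Reach (deleteEdge G u v) a b
    reroute u⇝v here = here
    reroute u⇝v (step {a} {z} az z⇝b) with sameEdge? u v a z
    ... | yes (inj₁ (refl , refl)) = Reach-trans u⇝v (reroute u⇝v z⇝b)
    ... | yes (inj₂ (refl , refl)) = Reach-trans (Reach-sym (Graph.sym (withoutEdge G u v)) u⇝v) (reroute u⇝v z⇝b)
    ... | no ¬uv                   = step (deleteEdge-keeps G u v az ¬uv) (reroute u⇝v z⇝b)

  complete-neighbours : ∀ G {x} {ys : List (Fin (n G))} → degree G x ≡ length ys → Unique ys →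
                        All (λ y → adj G x y ≡ true) ys → ∀ {z} → adj G x z ≡ true → z ∈ ys
  complete-neighbours G {x} {ys} deg≡ ys! adj-ys {z} xz with Any.any? (z ≟_) ys
  ... | yes z∈ys = z∈ys
  ... | no  z∉ys = contradiction (subst (length ys <_) (trans (sym (degree≡count G x)) deg≡)
                                        (length≤count (¬Any⇒All¬ ys z∉ys ∷ ys!) (xz ∷ adj-ys)))
                                 (<-irrefl refl)

  degree1-unique : ∀ G {x y z} → degree G x ≡ 1 → adj G x y ≡ true → adj G x z ≡ true → y ≡ z
  degree1-unique G deg1 xy xz with complete-neighbours G deg1 ([] ∷ []) (xy ∷ []) xz
  ... | here z≡y = sym z≡y

  leaf-bridge : ∀ G {x y} → degree G x ≡ 1 → adj G x y ≡ true → IsBridge G x y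
  leaf-bridge G {x} {y} deg1 xy = xy , λ x⇝y → stuck x⇝y refl
    where
    stuck : ∀ {w} → Reach (deleteEdge G x y) x w → w ≡ y → ⊥
    stuck here x≡y = adjacent⇒distinct G xy x≡y
    stuck (step {v = z} xz _) _ with degree1-unique G deg1 xy (deleteEdge-edge G x y xz)
    ... | refl = false≢true (trans (sym (deleteEdge-drops G x y (inj₁ (refl , refl)))) xz)

  deleteEdge-comm : ∀ G u v x y → deleteEdge G v u x y ≡ deleteEdge G u v x y
  deleteEdge-comm G u v x y = cong (λ b → adj G x y ∧ not b) (Bool.∨-comm (⌊ x ≟ v ⌋ ∧ ⌊ y ≟ u ⌋) _)

  bridge-sym : ∀ {G u v} → IsBridge G u v → IsBridge G v u
  bridge-sym {G} {u} {v} (uv , ¬u⇝v) =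
    trans (Graph.sym G v u) uv ,
    λ v⇝u → ¬u⇝v (Reach-sym (Graph.sym (withoutEdge G u v))
                           (Reach-map (λ x y e → trans (sym (deleteEdge-comm G u v x y)) e) v⇝u))

  bridge-induced : ∀ {G} M {x y} → IsBridge G x y → adj (induced G M) x y ≡ true → IsBridge (induced G M) x y
  bridge-induced {G} M {x} {y} (_ , ¬x⇝y) xy = xy , λ x⇝y → ¬x⇝y (Reach-map forget x⇝y)
    where
    forget : ∀ a b → deleteEdge (induced G M) x y a b ≡ true → deleteEdge G x y a b ≡ true
    forget a b e = cong₂ _∧_ (∧-conicalˡ (adj G a b) (M a ∧ M b) (∧-conicalˡ (adj G a b ∧ (M a ∧ M b)) _ e))
                             (∧-conicalʳ (adj G a b ∧ (M a ∧ M b)) _ e)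


  -- Forests

  toℕ-next : ∀ {m} (i : Fin (suc m)) → toℕ (next i) ≡ suc (toℕ i) ⊎ (suc (toℕ i) ≡ suc m × toℕ (next i) ≡ 0)
  toℕ-next {m} i with suc (toℕ i) <? suc m
  ... | yes i+1<m+1 = inj₁ (trans (toℕ-fromℕ< _) (m<n⇒m%n≡m i+1<m+1))
  ... | no  i+1≮m+1 = inj₂ (last , trans (toℕ-fromℕ< _) (trans (cong (_% suc m) last) (n%n≡0 (suc m))))
    where
    last : suc (toℕ i) ≡ suc m
    last = ≤-antisym (toℕ<n i) (≮⇒≥ i+1≮m+1)

  closedWalk⇒cycle : ∀ G k (w : ℕ → Fin (n G)) →
                     (∀ s → s < 3 + k → adj G (w s) (w (suc s)) ≡ true) → w (3 + k) ≡ w 0 →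
                     (∀ {s t} → s < 3 + k → t < 3 + k → w s ≡ w t → s ≡ t) → Cycle G
  closedWalk⇒cycle G k w edge closed injective = record
    { k = k ; c = w ∘ toℕ ; inj = λ {s} {t} → toℕ-injective ∘ injective (toℕ<n s) (toℕ<n t) ; edges = edges′ }
    where
    edges′ : ∀ i → adj G (w (toℕ i)) (w (toℕ (next i))) ≡ true
    edges′ i with toℕ-next i
    ... | inj₁ eq          rewrite eq = edge (toℕ i) (toℕ<n i)
    ... | inj₂ (last , eq) rewrite eq = subst (λ x → adj G (w (toℕ i)) x ≡ true)
                                               (trans (cong w last) closed) (edge (toℕ i) (toℕ<n i))

  least : ∀ {P : ℕ → Set} → Decidable P → ∀ {j} → P j → ∃ λ m → P m × (∀ {b} → b < m → ¬ P b)
  least {P} P? {j} = <-rec (λ j → P j → Minimum) search j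
    where
    Minimum = ∃ λ m → P m × (∀ {b} → b < m → ¬ P b)
    search : ∀ j → (∀ {i} → i < j → P i → Minimum) → P j → Minimum
    search j smaller pj with anyUpTo? P? j
    ... | yes (i , i<j , pi) = smaller i<j pi
    ... | no  none           = j , pj , λ b<j pb → none (_ , b<j , pb)

  another-neighbour : ∀ G z p → 2 ≤ degree G z → ∃ λ w → adj G z w ≡ true × w ≢ p
  another-neighbour G z p 2≤deg with count-witness₂ (adj G z) (subst (2 ≤_) (degree≡count G z) 2≤deg)
  ... | a , b , a≢b , za , zb with a ≟ p
  ...   | yes refl = b , zb , a≢b ∘ sym
  ...   | no  a≢p  = a , za , a≢p

  adjacent⇒1≤degree : ∀ G {x y} → adj G x y ≡ true → 1 ≤ degree G x
  adjacent⇒1≤degree G {x} xy = subst (1 ≤_) (sym (degree≡count G x)) (count-pos (adj G x) xy)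

  -- a walk that never turns straight back repeats a vertex, and its first repetition closes a cycle
  module _ (G : Graph) (min-degree-2 : ∀ z → 1 ≤ degree G z → 2 ≤ degree G z) {x : Fin (n G)} (x-active : 1 ≤ degree G x) where

    private
      V = Fin (n G)

      Arc : Set
      Arc = ∃₂ λ a b → adj G a b ≡ true

      onward : ((a , b , _) : Arc) → ∃ λ c → adj G b c ≡ true × c ≢ a
      onward (a , b , ab) = another-neighbour G b a (min-degree-2 b (adjacent⇒1≤degree G (trans (Graph.sym G b a) ab)))

      turn : Arc → Arc
      turn arc@(_ , b , _) = b , proj₁ (onward arc) , proj₁ (proj₂ (onward arc))

      start : Arc
      start with count-witness (adj G x) (subst (1 ≤_) (degree≡count G x) x-active)
      ... | y , xy = x , y , xy

      walk : ℕ → Arc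
      walk zero    = start
      walk (suc t) = turn (walk t)

      w : ℕ → V
      w t = proj₁ (walk t)

      walk-edge : ∀ t → adj G (w t) (w (suc t)) ≡ true
      walk-edge t = proj₂ (proj₂ (walk t))

      no-backtrack : ∀ t → w (suc (suc t)) ≢ w t
      no-backtrack t = proj₂ (proj₂ (onward (walk t)))

      Repeat : ℕ → Set
      Repeat j = ∃ λ i → i < j × w i ≡ w j

      first-repeat : ∃ λ j → Repeat j × (∀ {b} → b < j → ¬ Repeat b)
      first-repeat with pigeonhole (n<1+n (n G)) (w ∘ toℕ)
      ... | i , j , i<j , wi≡wj = least (λ j → anyUpTo? (λ i → w i ≟ w j) j) (toℕ i , i<j , wi≡wj)

    minDegree2⇒cycle : Cycle G
    minDegree2⇒cycle with first-repeat
    ... | j , (i , i<j , wi≡wj) , minimal =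
      closedWalk⇒cycle G m (λ s → w (i + s)) edge closed (λ s< t< → +-cancelˡ-≡ i _ _ ∘ injective (below s<) (below t<))
      where
      injective : ∀ {s t} → s < j → t < j → w s ≡ w t → s ≡ t
      injective {s} {t} s<j t<j ws≡wt with <-cmp s t
      ... | tri< s<t _ _ = contradiction (s , s<t , ws≡wt) (minimal t<j)
      ... | tri≈ _ s≡t _ = s≡t
      ... | tri> _ _ t<s = contradiction (t , t<s , sym ws≡wt) (minimal s<j)

      -- j = 1 + i would be a loop and j = 2 + i a backtrack
      3+i≤j : 3 + i ≤ j
      3+i≤j = ≤∧≢⇒< (≤∧≢⇒< i<j (λ 1+i≡j → adjacent⇒distinct G (walk-edge i) (trans wi≡wj (cong w (sym 1+i≡j)))))
                     (λ 2+i≡j → no-backtrack i (trans (cong w 2+i≡j) (sym wi≡wj)))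

      m : ℕ
      m = proj₁ (m≤n⇒∃[o]m+o≡n 3+i≤j)

      i+3+m≡j : i + (3 + m) ≡ j
      i+3+m≡j = trans (trans (sym (+-assoc i 3 m)) (cong (_+ m) (+-comm i 3))) (proj₂ (m≤n⇒∃[o]m+o≡n 3+i≤j))

      below : ∀ {s} → s < 3 + m → i + s < j
      below s<3+m = subst (_ <_) i+3+m≡j (+-monoʳ-< i s<3+m)

      edge : ∀ s → s < 3 + m → adj G (w (i + s)) (w (i + suc s)) ≡ true
      edge s _ rewrite +-suc i s = walk-edge (i + s)

      closed : w (i + (3 + m)) ≡ w (i + 0)
      closed = trans (cong w i+3+m≡j) (trans (sym wi≡wj) (cong w (sym (+-identityʳ i))))

  isPositive : ℕ → Bool
  isPositive zero    = false
  isPositive (suc _) = true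

  nonIsolated : (G : Graph) → Fin (n G) → Bool
  nonIsolated G x = isPositive (degree G x)

  isPositive-mono : ∀ {a b} → a ≤ b → 𝟙 (isPositive a) ≤ 𝟙 (isPositive b)
  isPositive-mono {zero}              _ = z≤n
  isPositive-mono {suc a} {suc b} _ = ≤-refl

  isPositive-true : ∀ {a} → 1 ≤ a → isPositive a ≡ true
  isPositive-true (s≤s _) = refl

  -- deleting the edge of a leaf isolates the leaf and isolates no other vertex
  nonIsolated-withoutLeafEdge : ∀ G {x y} → degree G x ≡ 1 → (xy : adj G x y ≡ true) →
    count (nonIsolated (withoutEdge G x y)) + 1 ≤ count (nonIsolated G)
  nonIsolated-withoutLeafEdge G {x} {y} deg1 xy = begin
    count (nonIsolated G′) + 1                                   ≡⟨ cong (count (nonIsolated G′) +_) (count-singleton x) ⟨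
    count (nonIsolated G′) + count (λ z → ⌊ z ≟ x ⌋)
      ≡⟨ ∑-distrib-+ (𝟙 ∘ nonIsolated G′) (λ z → 𝟙 ⌊ z ≟ x ⌋) ⟨
    sum (λ z → 𝟙 (nonIsolated G′ z) + 𝟙 ⌊ z ≟ x ⌋)             ≤⟨ sum-mono pointwise ⟩
    count (nonIsolated G)                                        ∎
    where
    open ≤-Reasoning
    G′ = withoutEdge G x y
    isolated : degree G′ x ≡ 0
    isolated = m+n≡0⇒m≡0 _ (suc-injective (trans (sym (+-suc _ _)) (trans (sym deg) deg1)))
      where
      deg : degree G x ≡ degree G′ x + suc (𝟙 ⌊ x ≟ y ⌋)
      deg = trans (degree-withoutEdge G xy x) (cong (λ b → degree G′ x + (𝟙 b + 𝟙 ⌊ x ≟ y ⌋)) (⌊⌋-yes (x ≟ x) refl))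
    at-leaf : 𝟙 (nonIsolated G′ x) + 𝟙 ⌊ x ≟ x ⌋ ≡ 𝟙 (nonIsolated G x)
    at-leaf = trans (cong₂ _+_ (cong (𝟙 ∘ isPositive) isolated) (cong 𝟙 (⌊⌋-yes (x ≟ x) refl)))
                    (cong (𝟙 ∘ isPositive) (sym deg1))
    elsewhere : ∀ z → z ≢ x → 𝟙 (nonIsolated G′ z) + 𝟙 ⌊ z ≟ x ⌋ ≤ 𝟙 (nonIsolated G z)
    elsewhere z z≢x = subst (_≤ 𝟙 (nonIsolated G z))
                            (trans (sym (+-identityʳ _)) (cong (λ b → 𝟙 (nonIsolated G′ z) + 𝟙 b) (sym (⌊⌋-no (z ≟ x) z≢x))))
                            (isPositive-mono (subst (degree G′ z ≤_) (sym (degree-withoutEdge G xy z)) (m≤m+n _ _)))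
    pointwise : ∀ z → 𝟙 (nonIsolated G′ z) + 𝟙 ⌊ z ≟ x ⌋ ≤ 𝟙 (nonIsolated G z)
    pointwise z = [ (λ { refl → ≤-reflexive at-leaf }) , elsewhere z ]′ (toSum (z ≟ x))

  single-edge-bound : ∀ G {x y} → adj G x y ≡ true → sum (degree G) ≡ 2 → sum (degree G) + 2 ≤ 2 * count (nonIsolated G)
  single-edge-bound G {x} {y} xy sum≡2 = subst (λ s → s + 2 ≤ 2 * count (nonIsolated G)) (sym sum≡2) (*-monoʳ-≤ 2
    (count≥2 (nonIsolated G) (adjacent⇒distinct G xy) (isPositive-true (adjacent⇒1≤degree G xy))
             (isPositive-true (adjacent⇒1≤degree G (trans (Graph.sym G y x) xy)))))

  private
    ForestBound : ℕ → Set
    ForestBound d = ∀ G → sum (degree G) ≡ d → ¬ Cycle G → ∀ {x} → 1 ≤ degree G x →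
                    sum (degree G) + 2 ≤ 2 * count (nonIsolated G)

  -- repeatedly delete the edge at a leaf; a graph without leaves contains a cycle
  forest-bound : ∀ G → ¬ Cycle G → ∀ {x} → 1 ≤ degree G x → sum (degree G) + 2 ≤ 2 * count (nonIsolated G)
  forest-bound G = <-rec ForestBound induct (sum (degree G)) G refl
    where
    induct : ∀ d → (∀ {d′} → d′ < d → ForestBound d′) → ForestBound d
    induct _ smaller G refl acyclic {x} x-active with any? (λ z → degree G z ℕ.≟ 1)
    ... | no no-leaf = contradiction (minDegree2⇒cycle G min-degree-2 x-active) acyclic
      where
      min-degree-2 : ∀ z → 1 ≤ degree G z → 2 ≤ degree G z
      min-degree-2 z z-active = ≤∧≢⇒< z-active (λ 1≡deg → no-leaf (z , sym 1≡deg))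
    ... | yes (ℓ , ℓ-leaf) = with-rest (any? (λ z → 1 ℕ.≤? degree G′ z))
      where
      ℓ-edge : ∃ λ y → adj G ℓ y ≡ true
      ℓ-edge = count-witness (adj G ℓ) (subst (1 ≤_) (trans (sym ℓ-leaf) (degree≡count G ℓ)) ≤-refl)
      y = proj₁ ℓ-edge
      ℓy = proj₂ ℓ-edge
      G′ = withoutEdge G ℓ y
      sum-eq : sum (degree G) ≡ sum (degree G′) + 2
      sum-eq = sum-degree-withoutEdge G ℓy
      cnt = count (nonIsolated G)
      cnt′ = count (nonIsolated G′)
      with-rest : Dec (∃ λ z → 1 ≤ degree G′ z) → sum (degree G) + 2 ≤ 2 * cnt
      with-rest (yes (z , z-active)) = begin
        sum (degree G) + 2            ≡⟨ cong (_+ 2) sum-eq ⟩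
        sum (degree G′) + 2 + 2       ≤⟨ +-monoˡ-≤ 2 (smaller shrink G′ refl (acyclic ∘ subgraph-cycle) z-active) ⟩
        2 * cnt′ + 2                  ≡⟨ *-distribˡ-+ 2 cnt′ 1 ⟨
        2 * (cnt′ + 1)                ≤⟨ *-monoʳ-≤ 2 (nonIsolated-withoutLeafEdge G ℓ-leaf ℓy) ⟩
        2 * cnt                       ∎
        where
        open ≤-Reasoning
        shrink : sum (degree G′) < sum (degree G)
        shrink = subst (sum (degree G′) <_) (sym sum-eq) (m<m+n _ (s≤s z≤n))
      with-rest (no no-edge) = single-edge-bound G ℓy (trans sum-eq (cong (_+ 2) (sum-zero isolated)))
        where
        isolated : ∀ z → degree G′ z ≡ 0
        isolated z = n≤0⇒n≡0 (≮⇒≥ (λ z-active → no-edge (z , z-active)))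


  -- Splitting a network at a bridge

  isLeaf isInternal : (G : Graph) → Fin (n G) → Bool
  isLeaf G x     = ⌊ degree G x ℕ.≟ 1 ⌋
  isInternal G x = ⌊ degree G x ℕ.≟ 3 ⌋

  leaves internals : Graph → ℕ
  leaves G    = count (isLeaf G)
  internals G = count (isInternal G)

  -- Isolated vertices are allowed so that both halves of a graph split along a bridge live on the
  -- original vertex set; for the same reason cut-edges are replaced by bridges.
  record IsNetwork (G : Graph) : Set where
    field
      degree-0-1-3 : ∀ x → degree G x ≡ 0 ⊎ degree G x ≡ 1 ⊎ degree G x ≡ 3
      reach        : ∀ {x y} → 1 ≤ degree G x → 1 ≤ degree G y → Reach (adj G) x y
      twoCuttable  : (C : Cycle G) → ∃ λ i → IncidentToBridge G (c C i) × IncidentToBridge G (c C (next i))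
      hasEdge      : ∃ λ x → 1 ≤ degree G x

  module Side {G : Graph} (N : IsNetwork G) {u v : Fin (n G)} (uv : IsBridge G u v)
              (reach? : ∀ x → Dec (Reach (deleteEdge G u v) u x)) where

    open IsNetwork N

    reached : Fin (n G) → Bool
    reached x = ⌊ reach? x ⌋

    member : Fin (n G) → Bool
    member x = reached x ∨ ⌊ x ≟ v ⌋

    side : Graph
    side = induced G member

    reached-u : reached u ≡ true
    reached-u = ⌊⌋-yes (reach? u) here

    unreached-v : reached v ≡ false
    unreached-v = ⌊⌋-no (reach? v) (proj₂ uv)

    reached-step : ∀ {x y} → reached x ≡ true → deleteEdge G u v x y ≡ true → reached y ≡ true
    reached-step {x} {y} rx e = ⌊⌋-yes (reach? y) (Reach-snoc (⌊⌋-sound (reach? x) rx) e)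

    reached-closed : ∀ {x y} → reached x ≡ true → adj G x y ≡ true → reached y ≡ true ⊎ (x ≡ u × y ≡ v)
    reached-closed {x} {y} rx xy with sameEdge? u v x y
    ... | yes (inj₁ x,y≡u,v)   = inj₂ x,y≡u,v
    ... | yes (inj₂ (refl , _)) = contradiction (trans (sym rx) unreached-v) λ ()
    ... | no ¬uv               = inj₁ (reached-step rx (deleteEdge-keeps G u v xy ¬uv))

    member-reached : ∀ {x} → reached x ≡ true → member x ≡ true
    member-reached rx = cong (_∨ _) rx

    member-v : member v ≡ true
    member-v = trans (cong (reached v ∨_) (⌊⌋-yes (v ≟ v) refl)) (Bool.∨-zeroʳ (reached v))

    member-closed : ∀ {x y} → reached x ≡ true → adj G x y ≡ true → member y ≡ true
    member-closed rx xy with reached-closed rx xy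
    ... | inj₁ ry             = member-reached ry
    ... | inj₂ (_ , refl)     = member-v

    classify : ∀ x → reached x ≡ true ⊎ x ≡ v ⊎ (reached x ≡ false × x ≢ v)
    classify x with reached x in rx | x ≟ v
    ... | true  | _        = inj₁ refl
    ... | false | yes x≡v  = inj₂ (inj₁ x≡v)
    ... | false | no x≢v   = inj₂ (inj₂ (refl , x≢v))

    degree-reached : ∀ {x} → reached x ≡ true → degree side x ≡ degree G x
    degree-reached rx = induced-degree-all G member (member-reached rx) (member-closed rx)

    degree-v : degree side v ≡ 1
    degree-v = induced-degree-one G member member-v (trans (Graph.sym G v u) (proj₁ uv)) (member-reached reached-u) only-u
      where
      only-u : ∀ {y} → adj G v y ≡ true → member y ≡ true → y ≡ u
      only-u {y} vy My with reached y in ry | y ≟ v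
      ... | false | yes refl = contradiction vy (λ e → adjacent⇒distinct G e refl)
      ... | true  | _ with reached-closed ry (trans (Graph.sym G y v) vy)
      ...   | inj₁ rv        = contradiction (trans (sym rv) unreached-v) λ ()
      ...   | inj₂ (y≡u , _) = y≡u

    degree-outside : ∀ {x} → reached x ≡ false → x ≢ v → degree side x ≡ 0
    degree-outside {x} ¬rx x≢v = induced-degree-none G member (cong₂ _∨_ ¬rx (⌊⌋-no (x ≟ v) x≢v))

    side-edge : ∀ {x y} → adj G x y ≡ true → member x ≡ true → member y ≡ true → adj side x y ≡ true
    side-edge xy Mx My = cong₂ _∧_ xy (cong₂ _∧_ Mx My)

    side-member : ∀ {x y} → adj side x y ≡ true → member x ≡ true
    side-member {x} {y} e = ∧-conicalˡ (member x) (member y) (∧-conicalʳ (adj G x y) _ e)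

    reach-from-u : ∀ {x} → 1 ≤ degree side x → Reach (adj side) u x
    reach-from-u {x} x-active with classify x
    ... | inj₁ rx = Reach-within reached-step (λ ra rb e → side-edge (deleteEdge-edge G u v e) (member-reached ra) (member-reached rb))
                                 (⌊⌋-sound (reach? x) rx) reached-u
    ... | inj₂ (inj₁ refl)        = step (side-edge (proj₁ uv) (member-reached reached-u) member-v) here
    ... | inj₂ (inj₂ (¬rx , x≢v)) = contradiction (subst (1 ≤_) (degree-outside ¬rx x≢v) x-active) λ ()

    bridge-in-side : ∀ {x} → member x ≡ true → IncidentToBridge G x → IncidentToBridge side x
    bridge-in-side {x} Mx (y , xy) with classify x
    ... | inj₁ rx = y , bridge-induced {G} member xy (side-edge (proj₁ xy) Mx (member-closed rx (proj₁ xy)))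
    ... | inj₂ (inj₁ refl) =
      u , leaf-bridge side degree-v (side-edge (trans (Graph.sym G v u) (proj₁ uv)) member-v (member-reached reached-u))
    ... | inj₂ (inj₂ (¬rx , x≢v)) = contradiction (trans (sym Mx) (cong₂ _∨_ ¬rx (⌊⌋-no (x ≟ v) x≢v))) λ ()

    side-isNetwork : IsNetwork side
    side-isNetwork = record
      { degree-0-1-3 = degrees
      ; reach        = λ x-active y-active → Reach-trans (Reach-sym (Graph.sym side) (reach-from-u x-active)) (reach-from-u y-active)
      ; twoCuttable  = cuttable
      ; hasEdge      = u , subst (1 ≤_) (sym (degree-reached reached-u)) (adjacent⇒1≤degree G (proj₁ uv))
      }
      where
      degrees : ∀ x → degree side x ≡ 0 ⊎ degree side x ≡ 1 ⊎ degree side x ≡ 3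
      degrees x with classify x
      ... | inj₁ rx rewrite degree-reached rx = degree-0-1-3 x
      ... | inj₂ (inj₁ refl)        = inj₂ (inj₁ degree-v)
      ... | inj₂ (inj₂ (¬rx , x≢v)) = inj₁ (degree-outside ¬rx x≢v)

      cuttable : (C : Cycle side) → ∃ λ i → IncidentToBridge side (c C i) × IncidentToBridge side (c C (next i))
      cuttable C with twoCuttable (subgraph-cycle C)
      ... | i , bᵢ , bₙ = i , bridge-in-side (side-member (edges C i)) bᵢ , bridge-in-side (side-member (edges C (next i))) bₙ

  module Split {G : Graph} (N : IsNetwork G) {u v : Fin (n G)} (du : degree G u ≡ 3) (dv : degree G v ≡ 3) (uv : IsBridge G u v)
               (reachᵤ? : ∀ x → Dec (Reach (deleteEdge G u v) u x))
               (reachᵥ? : ∀ x → Dec (Reach (deleteEdge G v u) v x)) where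

    open IsNetwork N
    module A = Side N uv reachᵤ?
    module B = Side N (bridge-sym {G} uv) reachᵥ?

    A-side B-side : Graph
    A-side = A.side
    B-side = B.side

    private
      dG dA dB : Fin (n G) → ℕ
      dG = degree G
      dA = degree A-side
      dB = degree B-side

    exclusive : ∀ {x} → A.reached x ≡ true → B.reached x ≡ false
    exclusive {x} Ax with B.reached x in Bx
    ... | false = refl
    ... | true  = contradiction u⇝v (proj₂ uv)
      where
      u⇝v : Reach (deleteEdge G u v) u v
      u⇝v = Reach-trans (⌊⌋-sound (reachᵤ? x) Ax)
              (Reach-sym (Graph.sym (withoutEdge G u v))
                (Reach-map (λ a b e → trans (sym (deleteEdge-comm G u v a b)) e) (⌊⌋-sound (reachᵥ? x) Bx)))

    -- a path from u leaves u's side only through the bridge itself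
    reach-split : ∀ {s x} → Reach (adj G) s x → Reach (deleteEdge G u v) u s ⊎ Reach (deleteEdge G v u) v s →
                  Reach (deleteEdge G u v) u x ⊎ Reach (deleteEdge G v u) v x
    reach-split here r = r
    reach-split (step {s} {z} sz z⇝x) r with sameEdge? u v s z
    ... | yes (inj₁ (_ , refl)) = reach-split z⇝x (inj₂ here)
    ... | yes (inj₂ (_ , refl)) = reach-split z⇝x (inj₁ here)
    ... | no ¬uv = reach-split z⇝x (Sum.map (λ u⇝s → Reach-snoc u⇝s (deleteEdge-keeps G u v sz ¬uv))
                                            (λ v⇝s → Reach-snoc v⇝s (deleteEdge-keeps G v u sz (¬uv ∘ swap-edge))) r)
      where
      swap-edge : SameEdge v u s z → SameEdge u v s z
      swap-edge = [ inj₂ , inj₁ ]′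

    cover : ∀ {x} → 1 ≤ dG x → A.reached x ≡ true ⊎ B.reached x ≡ true
    cover {x} x-active with reach-split (reach (subst (1 ≤_) (sym du) (s≤s z≤n)) x-active) (inj₁ here)
    ... | inj₁ u⇝x = inj₁ (⌊⌋-yes (reachᵤ? x) u⇝x)
    ... | inj₂ v⇝x = inj₂ (⌊⌋-yes (reachᵥ? x) v⇝x)

    private
      u≢v : u ≢ v
      u≢v = adjacent⇒distinct G (proj₁ uv)

      dA-u : dA u ≡ 3
      dA-u = trans (A.degree-reached A.reached-u) du

      dB-v : dB v ≡ 3
      dB-v = trans (B.degree-reached B.reached-u) dv

    data Profile (x : Fin (n G)) : Set where
      on-A : dA x ≡ dG x → dB x ≡ 0 → x ≢ u → x ≢ v → Profile x
      on-B : dA x ≡ 0 → dB x ≡ dG x → x ≢ u → x ≢ v → Profile x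
      at-u : x ≡ u → Profile x
      at-v : x ≡ v → Profile x

    profile : ∀ x → Profile x
    profile x with A.classify x | B.classify x
    ... | inj₁ Ax | inj₁ Bx = contradiction (trans (sym Bx) (exclusive Ax)) λ ()
    ... | _       | inj₂ (inj₁ x≡u) = at-u x≡u
    ... | inj₂ (inj₁ x≡v) | _       = at-v x≡v
    ... | inj₁ Ax | inj₂ (inj₂ (¬Bx , x≢u)) =
      on-A (A.degree-reached Ax) (B.degree-outside ¬Bx x≢u) x≢u (λ { refl → contradiction (trans (sym Ax) A.unreached-v) λ () })
    ... | inj₂ (inj₂ (¬Ax , x≢v)) | inj₁ Bx =
      on-B (A.degree-outside ¬Ax x≢v) (B.degree-reached Bx) (λ { refl → contradiction (trans (sym Bx) B.unreached-v) λ () }) x≢v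
    ... | inj₂ (inj₂ (¬Ax , x≢v)) | inj₂ (inj₂ (¬Bx , x≢u)) =
      on-A (trans (A.degree-outside ¬Ax x≢v) (sym isolated)) (B.degree-outside ¬Bx x≢u) x≢u x≢v
      where
      isolated : dG x ≡ 0
      isolated = n≤0⇒n≡0 (≮⇒≥ λ x-active → [ (λ Ax → contradiction (trans (sym Ax) ¬Ax) λ ()) ,
                                               (λ Bx → contradiction (trans (sym Bx) ¬Bx) λ ()) ]′ (cover x-active))

    internal-split-at : ∀ x → [ dG x ≡ 3 ] ≡ [ dA x ≡ 3 ] + [ dB x ≡ 3 ]
    internal-split-at x with profile x
    ... | on-A eA eB _ _ = sym (trans (cong₂ _+_ (cong [_≡ 3 ] eA) (cong [_≡ 3 ] eB)) (+-identityʳ _))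
    ... | on-B eA eB _ _ = sym (cong₂ _+_ (cong [_≡ 3 ] eA) (cong [_≡ 3 ] eB))
    ... | at-u refl = trans (cong [_≡ 3 ] du) (sym (cong₂ _+_ (cong [_≡ 3 ] dA-u) (cong [_≡ 3 ] B.degree-v)))
    ... | at-v refl = trans (cong [_≡ 3 ] dv) (sym (cong₂ _+_ (cong [_≡ 3 ] A.degree-v) (cong [_≡ 3 ] dB-v)))

    private
      endpoint : Fin (n G) → ℕ
      endpoint x = 𝟙 ⌊ x ≟ u ⌋ + 𝟙 ⌊ x ≟ v ⌋

      endpoint-elsewhere : ∀ {x} → x ≢ u → x ≢ v → endpoint x ≡ 0
      endpoint-elsewhere {x} x≢u x≢v = cong₂ _+_ (cong 𝟙 (⌊⌋-no (x ≟ u) x≢u)) (cong 𝟙 (⌊⌋-no (x ≟ v) x≢v))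

      endpoint-u : endpoint u ≡ 1
      endpoint-u = cong₂ _+_ (cong 𝟙 (⌊⌋-yes (u ≟ u) refl)) (cong 𝟙 (⌊⌋-no (u ≟ v) u≢v))

      endpoint-v : endpoint v ≡ 1
      endpoint-v = cong₂ _+_ (cong 𝟙 (⌊⌋-no (v ≟ u) (u≢v ∘ sym))) (cong 𝟙 (⌊⌋-yes (v ≟ v) refl))

    leaf-split-at : ∀ x → [ dA x ≡ 1 ] + [ dB x ≡ 1 ] ≡ [ dG x ≡ 1 ] + endpoint x
    leaf-split-at x with profile x
    ... | on-A eA eB x≢u x≢v = trans (cong₂ _+_ (cong [_≡ 1 ] eA) (cong [_≡ 1 ] eB))
                                      (cong ([ dG x ≡ 1 ] +_) (sym (endpoint-elsewhere x≢u x≢v)))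
    ... | on-B eA eB x≢u x≢v = trans (cong₂ _+_ (cong [_≡ 1 ] eA) (cong [_≡ 1 ] eB))
                                      (trans (sym (+-identityʳ _)) (cong ([ dG x ≡ 1 ] +_) (sym (endpoint-elsewhere x≢u x≢v))))
    ... | at-u refl = trans (cong₂ _+_ (cong [_≡ 1 ] dA-u) (cong [_≡ 1 ] B.degree-v))
                            (sym (cong₂ _+_ (cong [_≡ 1 ] du) endpoint-u))
    ... | at-v refl = trans (cong₂ _+_ (cong [_≡ 1 ] A.degree-v) (cong [_≡ 1 ] dB-v))
                            (sym (cong₂ _+_ (cong [_≡ 1 ] dv) endpoint-v))

    internals-split : internals G ≡ internals A-side + internals B-side
    internals-split = trans (sum-cong-≗ internal-split-at) (∑-distrib-+ ([_≡ 3 ] ∘ dA) ([_≡ 3 ] ∘ dB))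

    leaves-split : leaves A-side + leaves B-side ≡ leaves G + 2
    leaves-split = begin
      leaves A-side + leaves B-side                ≡⟨ ∑-distrib-+ ([_≡ 1 ] ∘ dA) ([_≡ 1 ] ∘ dB) ⟨
      sum (λ x → [ dA x ≡ 1 ] + [ dB x ≡ 1 ])      ≡⟨ sum-cong-≗ leaf-split-at ⟩
      sum (λ x → [ dG x ≡ 1 ] + endpoint x)        ≡⟨ ∑-distrib-+ ([_≡ 1 ] ∘ dG) endpoint ⟩
      leaves G + sum endpoint                      ≡⟨ cong (leaves G +_) (∑-distrib-+ (λ x → 𝟙 ⌊ x ≟ u ⌋) (λ x → 𝟙 ⌊ x ≟ v ⌋)) ⟩
      leaves G + (count (λ x → ⌊ x ≟ u ⌋) + count (λ x → ⌊ x ≟ v ⌋))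
                                                   ≡⟨ cong (leaves G +_) (cong₂ _+_ (count-singleton u) (count-singleton v)) ⟩
      leaves G + 2                                 ∎
      where
      open ≡-Reasoning

    A-internal : 1 ≤ internals A-side
    A-internal = count-pos (isInternal A-side) (⌊⌋-yes (dA u ℕ.≟ 3) dA-u)

    B-internal : 1 ≤ internals B-side
    B-internal = count-pos (isInternal B-side) (⌊⌋-yes (dB v ℕ.≟ 3) dB-v)


  -- Networks whose bridges end in leaves

  halves : ∀ a b c → a + (b + b) ≡ c + c → ∃ λ e → a ≡ e + e
  halves a zero    c eq = c , trans (sym (+-identityʳ a)) eq
  halves a (suc b) zero eq = contradiction (trans (sym (+-suc a (b + suc b))) eq) λ ()
  halves a (suc b) (suc c) eq = halves a b c (suc-injective (suc-injective (begin
    suc (suc (a + (b + b)))  ≡⟨ cong suc (+-suc a (b + b)) ⟨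
    suc (a + suc (b + b))    ≡⟨ +-suc a (suc (b + b)) ⟨
    a + suc (suc (b + b))    ≡⟨ cong (λ m → a + suc m) (+-suc b b) ⟨
    a + (suc b + suc b)      ≡⟨ eq ⟩
    suc c + suc c            ≡⟨ cong suc (+-suc c c) ⟩
    suc (suc (c + c))        ∎)))
    where
    open ≡-Reasoning

  forest-arith : ∀ {S y A N} → S + 2 ≤ 2 * A → S + y ≡ A + A + N → N + 2 ≤ y
  forest-arith {S} {y} {A} {N} forest total = +-cancelˡ-≤ S (N + 2) y (begin
    S + (N + 2)    ≡⟨ shuffle S N ⟩
    S + 2 + N      ≤⟨ +-monoˡ-≤ N forest ⟩
    2 * A + N      ≡⟨ cong (_+ N) (double A) ⟩
    A + A + N      ≡⟨ total ⟨
    S + y          ∎)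
    where
    open ≤-Reasoning
    shuffle : ∀ S N → S + (N + 2) ≡ S + 2 + N
    shuffle = solve-∀
    double : ∀ A → 2 * A ≡ A + A
    double = solve-∀

  -- y ≥ N + 2 ≥ 3 is even, so y ≥ 4
  boundary-arith : ∀ {N y t e} → 1 ≤ N → N + 2 ≤ y → y ≤ t → y ≡ e + e → t + N + 6 ≤ 3 * t
  boundary-arith {N} {y} {t} {e} 1≤N N+2≤y y≤t y≡e+e = begin
    t + N + 6          ≡⟨ shuffle t N ⟩
    t + (N + 2) + 4    ≤⟨ +-mono-≤ (+-monoʳ-≤ t N+2≤y) four≤y ⟩
    t + y + y          ≤⟨ +-mono-≤ (+-monoʳ-≤ t y≤t) y≤t ⟩
    t + t + t          ≡⟨ triple t ⟨
    3 * t              ∎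
    where
    open ≤-Reasoning
    shuffle : ∀ t N → t + N + 6 ≡ t + (N + 2) + 4
    shuffle = solve-∀
    triple : ∀ t → 3 * t ≡ t + t + t
    triple = solve-∀
    2≤e : 2 ≤ e
    2≤e with e ℕ.≤? 1
    ... | no e≰1 = ≰⇒> e≰1
    ... | yes e≤1 = contradiction (subst (3 ≤_) y≡e+e (≤-trans (+-monoˡ-≤ 2 1≤N) N+2≤y)) (≤⇒≯ (+-mono-≤ e≤1 e≤1))
    four≤y : 4 ≤ y
    four≤y = subst (4 ≤_) (sym y≡e+e) (+-mono-≤ 2≤e 2≤e)

  interior-free-arith : ∀ {t} → 3 ≤ t → t + 0 + 6 ≤ 3 * t
  interior-free-arith {t} 3≤t = begin
    t + 0 + 6          ≤⟨ +-monoʳ-≤ (t + 0) (+-mono-≤ 3≤t 3≤t) ⟩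
    t + 0 + (t + t)    ≡⟨ triple t ⟨
    3 * t              ∎
    where
    open ≤-Reasoning
    triple : ∀ t → 3 * t ≡ t + 0 + (t + t)
    triple = solve-∀

  module Base {G : Graph} (N : IsNetwork G)
              (no-internal-bridge : ∀ {u v} → degree G u ≡ 3 → degree G v ≡ 3 → ¬ IsBridge G u v) where

    open IsNetwork N

    neighbour-degree : ∀ {x y} → adj G x y ≡ true → degree G y ≡ 1 ⊎ degree G y ≡ 3
    neighbour-degree {x} {y} xy with degree-0-1-3 y
    ... | inj₁ d≡0 = contradiction (subst (1 ≤_) d≡0 (adjacent⇒1≤degree G (trans (Graph.sym G y x) xy))) λ ()
    ... | inj₂ d   = d

    internal-active : ∀ {x} → degree G x ≡ 3 → 1 ≤ degree G x
    internal-active deg3 = subst (1 ≤_) (sym deg3) (s≤s z≤n)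

    leaf-neighbour : ∀ {l x y} → degree G l ≡ 1 → adj G l x ≡ true → adj G l y ≡ true → y ≡ x
    leaf-neighbour deg1 lx ly = degree1-unique G deg1 ly lx

    internals≥ : ∀ {xs} → Unique xs → All (λ x → degree G x ≡ 3) xs → length xs ≤ internals G
    internals≥ xs! deg3 = length≤count xs! (All.map (⌊⌋-yes (_ ℕ.≟ 3)) deg3)

    leaves≥ : ∀ {xs} → Unique xs → All (λ x → degree G x ≡ 1) xs → length xs ≤ leaves G
    leaves≥ xs! deg1 = length≤count xs! (All.map (⌊⌋-yes (_ ℕ.≟ 1)) deg1)

    no-internals : internals G ≡ 0 → internals G + 6 ≤ 3 * leaves G
    no-internals none = subst (λ i → i + 6 ≤ 3 * leaves G) (sym none) (*-monoʳ-≤ 3 two-leaves)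
      where
      not-internal : ∀ {x} → degree G x ≢ 3
      not-internal {x} deg3 = contradiction (subst (1 ≤_) none (internals≥ {x ∷ []} ([] ∷ []) (deg3 ∷ []))) λ ()
      two-leaves : 2 ≤ leaves G
      two-leaves with hasEdge
      ... | x , x-active with count-witness (adj G x) (subst (1 ≤_) (degree≡count G x) x-active)
      ...   | y , xy with degree-0-1-3 x | neighbour-degree xy
      ...     | inj₁ d≡0              | _          = contradiction (subst (1 ≤_) d≡0 x-active) λ ()
      ...     | inj₂ (inj₂ deg3)      | _          = contradiction deg3 not-internal
      ...     | _                     | inj₂ deg3  = contradiction deg3 not-internal
      ...     | inj₂ (inj₁ x-leaf)    | inj₁ y-leaf =
        leaves≥ ((adjacent⇒distinct G xy ∷ []) ∷ [] ∷ []) (x-leaf ∷ y-leaf ∷ [])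

    leafNeighbours : Fin (n G) → ℕ
    leafNeighbours x = count (λ y → adj G x y ∧ isLeaf G y)

    -- an internal vertex carrying two leaves is the centre of a star with three leaves
    module Star {w l₁ l₂ x₃ : Fin (n G)} (w-internal : degree G w ≡ 3) (l₁-leaf : degree G l₁ ≡ 1) (l₂-leaf : degree G l₂ ≡ 1)
                (wl₁ : adj G w l₁ ≡ true) (wl₂ : adj G w l₂ ≡ true) (wx₃ : adj G w x₃ ≡ true)
                (l₁≢l₂ : l₁ ≢ l₂) (x₃≢l₁ : x₃ ≢ l₁) (x₃≢l₂ : x₃ ≢ l₂) where

      distinct : Unique (l₁ ∷ l₂ ∷ x₃ ∷ [])
      distinct = (l₁≢l₂ ∷ x₃≢l₁ ∘ sym ∷ []) ∷ (x₃≢l₂ ∘ sym ∷ []) ∷ [] ∷ []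

      w-neighbour : ∀ {z} → adj G w z ≡ true → z ∈ l₁ ∷ l₂ ∷ x₃ ∷ []
      w-neighbour = complete-neighbours G w-internal distinct (wl₁ ∷ wl₂ ∷ wx₃ ∷ [])

      back : ∀ {l z} → degree G l ≡ 1 → adj G w l ≡ true → adj G l z ≡ true → z ≡ w
      back deg1 wl lz = leaf-neighbour deg1 (trans (Graph.sym G _ w) wl) lz

      near-closed : Closed (deleteEdge G w x₃) (_∈ w ∷ l₁ ∷ l₂ ∷ [])
      near-closed (here refl) e with w-neighbour (deleteEdge-edge G w x₃ e)
      ... | here z≡l₁                 = there (here z≡l₁)
      ... | there (here z≡l₂)         = there (there (here z≡l₂))
      ... | there (there (here refl)) = contradiction (trans (sym e) (deleteEdge-drops G w x₃ (inj₁ (refl , refl)))) λ ()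
      near-closed (there (here refl))         e = here (back l₁-leaf wl₁ (deleteEdge-edge G w x₃ e))
      near-closed (there (there (here refl))) e = here (back l₂-leaf wl₂ (deleteEdge-edge G w x₃ e))

      x₃-far : ¬ x₃ ∈ w ∷ l₁ ∷ l₂ ∷ []
      x₃-far (here x₃≡w)                  = adjacent⇒distinct G wx₃ (sym x₃≡w)
      x₃-far (there (here x₃≡l₁))         = x₃≢l₁ x₃≡l₁
      x₃-far (there (there (here x₃≡l₂))) = x₃≢l₂ x₃≡l₂

      x₃-leaf : degree G x₃ ≡ 1
      x₃-leaf with neighbour-degree wx₃
      ... | inj₁ deg1 = deg1
      ... | inj₂ deg3 = contradiction (wx₃ , λ w⇝x₃ → x₃-far (Reach-closed near-closed w⇝x₃ (here refl)))
                                      (no-internal-bridge w-internal deg3)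

      star-closed : Closed (adj G) (_∈ w ∷ l₁ ∷ l₂ ∷ x₃ ∷ [])
      star-closed (here refl) e                         = there (w-neighbour e)
      star-closed (there (here refl)) e                 = here (back l₁-leaf wl₁ e)
      star-closed (there (there (here refl))) e         = here (back l₂-leaf wl₂ e)
      star-closed (there (there (there (here refl)))) e = here (back x₃-leaf wx₃ e)

      internal-in-star : ∀ {z} → degree G z ≡ 3 → z ∈ w ∷ l₁ ∷ l₂ ∷ x₃ ∷ [] → z ∈ w ∷ []
      internal-in-star deg3 (here z≡w)                          = here z≡w
      internal-in-star deg3 (there (here refl))                 = contradiction (trans (sym l₁-leaf) deg3) λ ()
      internal-in-star deg3 (there (there (here refl)))         = contradiction (trans (sym l₂-leaf) deg3) λ ()
      internal-in-star deg3 (there (there (there (here refl)))) = contradiction (trans (sym x₃-leaf) deg3) λ ()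

      one-internal : internals G ≤ 1
      one-internal = count≤length (w ∷ []) only-w
        where
        only-w : ∀ z → isInternal G z ≡ true → z ∈ w ∷ []
        only-w z z-internal = internal-in-star deg3
          (Reach-closed star-closed (reach (internal-active w-internal) (internal-active deg3)) (here refl))
          where
          deg3 = ⌊⌋-sound (degree G z ℕ.≟ 3) z-internal

      bound : internals G + 6 ≤ 3 * leaves G
      bound = begin
        internals G + 6    ≤⟨ +-monoˡ-≤ 6 one-internal ⟩
        7                  ≤⟨ s≤s (s≤s (s≤s (s≤s (s≤s (s≤s (s≤s z≤n)))))) ⟩
        3 * 3              ≤⟨ *-monoʳ-≤ 3 (leaves≥ distinct (l₁-leaf ∷ l₂-leaf ∷ x₃-leaf ∷ [])) ⟩
        3 * leaves G       ∎
        where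
        open ≤-Reasoning

    star : ∀ {w} → degree G w ≡ 3 → 2 ≤ leafNeighbours w → internals G + 6 ≤ 3 * leaves G
    star {w} w-internal 2≤leaves with count-witness₂ (λ y → adj G w y ∧ isLeaf G y) 2≤leaves
    ... | l₁ , l₂ , l₁≢l₂ , wl₁∧leaf , wl₂∧leaf
      with any? (λ z → (adj G w z Bool.≟ true) ×-dec ¬? (z ≟ l₁) ×-dec ¬? (z ≟ l₂))
    ... | yes (x₃ , wx₃ , x₃≢l₁ , x₃≢l₂) =
      Star.bound w-internal (leaf l₁ wl₁∧leaf) (leaf l₂ wl₂∧leaf) (edge l₁ wl₁∧leaf) (edge l₂ wl₂∧leaf) wx₃
                 l₁≢l₂ x₃≢l₁ x₃≢l₂
      where
      leaf : ∀ l → adj G w l ∧ isLeaf G l ≡ true → degree G l ≡ 1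
      leaf l e = ⌊⌋-sound (degree G l ℕ.≟ 1) (∧-conicalʳ (adj G w l) _ e)
      edge : ∀ l → adj G w l ∧ isLeaf G l ≡ true → adj G w l ≡ true
      edge l = ∧-conicalˡ (adj G w l) _
    ... | no no-third = contradiction (subst (_≤ 2) (trans (sym (degree≡count G w)) w-internal)
                                             (count≤length (l₁ ∷ l₂ ∷ []) only-two)) λ { (s≤s (s≤s ())) }
      where
      only-two : ∀ z → adj G w z ≡ true → z ∈ l₁ ∷ l₂ ∷ []
      only-two z wz with z ≟ l₁ | z ≟ l₂
      ... | yes z≡l₁ | _        = here z≡l₁
      ... | no _     | yes z≡l₂ = there (here z≡l₂)
      ... | no z≢l₁  | no z≢l₂  = contradiction (z , wz , z≢l₁ , z≢l₂) no-third

    module NonStar (some-internal : 1 ≤ internals G) (one-leaf : ∀ {w} → degree G w ≡ 3 → leafNeighbours w ≤ 1) where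

      private
        I L : Fin (n G) → Bool
        I = isInternal G
        L = isLeaf G

      internal-degree : ∀ {x} → I x ≡ true → degree G x ≡ 3
      internal-degree {x} = ⌊⌋-sound (degree G x ℕ.≟ 3)

      hasLeaf boundary : Fin (n G) → Bool
      hasLeaf x  = isPositive (leafNeighbours x)
      boundary x = I x ∧ hasLeaf x

      internalNeighbours : Fin (n G) → ℕ
      internalNeighbours x = count (λ y → adj G x y ∧ I y)

      leaf-attached-to-internal : ∀ {l y} → degree G l ≡ 1 → adj G l y ≡ true → degree G y ≡ 3
      leaf-attached-to-internal {l} {y} l-leaf ly with neighbour-degree ly | count-witness I some-internal
      ... | inj₂ deg3 | _ = deg3
      ... | inj₁ y-leaf | x₀ , x₀-internal =
        contradiction (Reach-closed pair-closed (reach l-active (internal-active deg3)) (here refl)) x₀-outside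
        where
        deg3 = internal-degree x₀-internal
        l-active = subst (1 ≤_) (sym l-leaf) (s≤s z≤n)
        pair-closed : Closed (adj G) (_∈ l ∷ y ∷ [])
        pair-closed (here refl)         e = there (here (leaf-neighbour l-leaf ly e))
        pair-closed (there (here refl)) e = here (leaf-neighbour y-leaf (trans (Graph.sym G y l) ly) e)
        x₀-outside : ¬ x₀ ∈ l ∷ y ∷ []
        x₀-outside (here refl)         = contradiction (trans (sym l-leaf) deg3) λ ()
        x₀-outside (there (here refl)) = contradiction (trans (sym y-leaf) deg3) λ ()

      degree-split : ∀ x → degree G x ≡ leafNeighbours x + internalNeighbours x
      degree-split x = trans (degree≡count G x) (trans (count-split (adj G x) L) (cong (leafNeighbours x +_) (sum-cong-≗ pointwise)))
        where
        pointwise : ∀ y → 𝟙 (adj G x y ∧ not (L y)) ≡ 𝟙 (adj G x y ∧ I y)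
        pointwise y with adj G x y in xy
        ... | false = refl
        ... | true with neighbour-degree xy
        ...   | inj₁ deg1 rewrite deg1 = refl
        ...   | inj₂ deg3 rewrite deg3 = refl

      K : Graph
      K = subgraph G (λ x y → (I x ∧ I y) ∧ not (boundary x ∧ boundary y))
                     (λ x y → cong₂ (λ a b → a ∧ not b) (Bool.∧-comm (I x) (I y)) (Bool.∧-comm (boundary x) (boundary y)))

      R : Graph
      R = induced G boundary

      leafNeighbours≡ : ∀ {x} → degree G x ≡ 3 → leafNeighbours x ≡ 𝟙 (hasLeaf x)
      leafNeighbours≡ {x} deg3 with leafNeighbours x | one-leaf deg3
      ... | zero  | _ = refl
      ... | suc zero | _ = refl
      ... | suc (suc _) | s≤s ()

      internalNeighbours≡ : ∀ {x} → degree G x ≡ 3 → 𝟙 (hasLeaf x) + internalNeighbours x ≡ 3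
      internalNeighbours≡ {x} deg3 = trans (cong (_+ internalNeighbours x) (sym (leafNeighbours≡ deg3)))
                                           (trans (sym (degree-split x)) deg3)

      K-degree-external : ∀ {x} → I x ≡ false → degree K x ≡ 0
      K-degree-external {x} ¬Ix = trans (degree≡count K x) (sum-zero pointwise)
        where
        pointwise : ∀ y → 𝟙 (adj K x y) ≡ 0
        pointwise y = trans (cong (λ i → 𝟙 (adj G x y ∧ ((i ∧ I y) ∧ not ((i ∧ hasLeaf x) ∧ boundary y)))) ¬Ix)
                            (cong 𝟙 (Bool.∧-zeroʳ (adj G x y)))

      K-degree-interior : ∀ {x} → I x ≡ true → hasLeaf x ≡ false → degree K x ≡ 3
      K-degree-interior {x} Ix ¬hx = trans (degree≡count K x) (trans (sum-cong-≗ pointwise)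
                                       (trans (cong (_+ internalNeighbours x) (sym (cong 𝟙 ¬hx)))
                                              (internalNeighbours≡ (internal-degree Ix))))
        where
        pointwise : ∀ y → 𝟙 (adj K x y) ≡ 𝟙 (adj G x y ∧ I y)
        pointwise y = trans (cong₂ (λ i h → 𝟙 (adj G x y ∧ ((i ∧ I y) ∧ not ((i ∧ h) ∧ boundary y)))) Ix ¬hx)
                            (cong (λ b → 𝟙 (adj G x y ∧ b)) (Bool.∧-identityʳ (I y)))

      KR-degree-boundary : ∀ {x} → boundary x ≡ true → degree K x + degree R x ≡ 2
      KR-degree-boundary {x} Tx = begin
        degree K x + degree R x        ≡⟨ cong₂ _+_ (degree≡count K x) (degree≡count R x) ⟩
        sum inK + sum inR                  ≡⟨ ∑-distrib-+ inK inR ⟨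
        sum (λ y → inK y + inR y)          ≡⟨ sum-cong-≗ pointwise ⟩
        internalNeighbours x           ≡⟨ suc-injective (trans (cong (λ b → 𝟙 b + internalNeighbours x) (sym hx))
                                                                (internalNeighbours≡ (internal-degree Ix))) ⟩
        2                              ∎
        where
        open ≡-Reasoning
        Ix = ∧-conicalˡ (I x) (hasLeaf x) Tx
        hx = ∧-conicalʳ (I x) (hasLeaf x) Tx
        inK inR : Fin (n G) → ℕ
        inK y = 𝟙 (adj K x y)
        inR y = 𝟙 (adj R x y)
        split : ∀ a i h → 𝟙 (a ∧ (i ∧ not (i ∧ h))) + 𝟙 (a ∧ (i ∧ h)) ≡ 𝟙 (a ∧ i)
        split false i     h     = refl
        split true  false h     = refl
        split true  true  false = refl
        split true  true  true  = refl
        pointwise : ∀ y → inK y + inR y ≡ 𝟙 (adj G x y ∧ I y)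
        pointwise y = trans (cong₂ (λ i h → 𝟙 (adj G x y ∧ ((i ∧ I y) ∧ not ((i ∧ h) ∧ boundary y)))
                                           + 𝟙 (adj G x y ∧ ((i ∧ h) ∧ boundary y))) Ix hx)
                            (split (adj G x y) (I y) (hasLeaf y))

      R-degree-inner : ∀ {x} → boundary x ≡ false → degree R x ≡ 0
      R-degree-inner = induced-degree-none G boundary

      interior : Fin (n G) → Bool
      interior x = I x ∧ not (hasLeaf x)

      private
        active : Fin (n G) → ℕ
        active x = 𝟙 (nonIsolated K x)

        boundary-core : ∀ a b → a + b ≡ 2 → a + [ b ≡ 1 ] ≡ 𝟙 (isPositive a) + 𝟙 (isPositive a) + 0
        boundary-core 0 2 refl = refl
        boundary-core 1 1 refl = refl
        boundary-core 2 0 refl = refl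

      K-degree-identity : ∀ x → degree K x + [ degree R x ≡ 1 ] ≡ active x + active x + 𝟙 (interior x)
      K-degree-identity x = by-cases (I x) refl (hasLeaf x) refl
        where
        via : ∀ {dK dR c} → degree K x ≡ dK → degree R x ≡ dR → 𝟙 (interior x) ≡ c →
              dK + [ dR ≡ 1 ] ≡ 𝟙 (isPositive dK) + 𝟙 (isPositive dK) + c →
              degree K x + [ degree R x ≡ 1 ] ≡ active x + active x + 𝟙 (interior x)
        via eK eR ec core rewrite eK | eR | ec = core
        by-cases : ∀ i → I x ≡ i → ∀ h → hasLeaf x ≡ h →
                   degree K x + [ degree R x ≡ 1 ] ≡ active x + active x + 𝟙 (interior x)
        by-cases false Ix _ _ = via (K-degree-external Ix) (R-degree-inner (cong (_∧ hasLeaf x) Ix))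
                                    (cong (λ i → 𝟙 (i ∧ not (hasLeaf x))) Ix) refl
        by-cases true Ix false hx = via (K-degree-interior Ix hx) (R-degree-inner (cong₂ _∧_ Ix hx))
                                         (cong₂ (λ i h → 𝟙 (i ∧ not h)) Ix hx) refl
        by-cases true Ix true hx = via refl refl (cong₂ (λ i h → 𝟙 (i ∧ not h)) Ix hx)
                                        (boundary-core (degree K x) (degree R x) (KR-degree-boundary (cong₂ _∧_ Ix hx)))

      nEnds nInterior nBoundary : ℕ
      nEnds = sum (λ x → [ degree R x ≡ 1 ])
      nInterior = count interior
      nBoundary  = count boundary

      sum-identity : sum (degree K) + nEnds ≡ count (nonIsolated K) + count (nonIsolated K) + nInterior
      sum-identity = begin
        sum (degree K) + nEnds                                     ≡⟨ ∑-distrib-+ (degree K) (λ x → [ degree R x ≡ 1 ]) ⟨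
        sum (λ x → degree K x + [ degree R x ≡ 1 ])                ≡⟨ sum-cong-≗ K-degree-identity ⟩
        sum (λ x → active x + active x + 𝟙 (interior x))           ≡⟨ ∑-distrib-+ (λ x → active x + active x) (𝟙 ∘ interior) ⟩
        sum (λ x → active x + active x) + nInterior                ≡⟨ cong (_+ nInterior) (∑-distrib-+ active active) ⟩
        count (nonIsolated K) + count (nonIsolated K) + nInterior  ∎
        where
        open ≡-Reasoning

      boundary-of-bridge : ∀ {x} → I x ≡ true → IncidentToBridge G x → boundary x ≡ true
      boundary-of-bridge {x} Ix (y , xy) with neighbour-degree (proj₁ xy)
      ... | inj₂ deg3 = contradiction xy (no-internal-bridge (internal-degree Ix) deg3)
      ... | inj₁ deg1 = cong₂ _∧_ Ix (isPositive-true (count-pos (λ z → adj G x z ∧ isLeaf G z)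
                                                                 (cong₂ _∧_ (proj₁ xy) (⌊⌋-yes (degree G y ℕ.≟ 1) deg1))))

      K-edge : ∀ {x y} → adj K x y ≡ true → I x ≡ true × I y ≡ true × not (boundary x ∧ boundary y) ≡ true
      K-edge {x} {y} xy = ∧-conicalˡ (I x) (I y) both , ∧-conicalʳ (I x) (I y) both , ∧-conicalʳ (I x ∧ I y) _ kept
        where
        kept = ∧-conicalʳ (adj G x y) _ xy
        both = ∧-conicalˡ (I x ∧ I y) _ kept

      -- every cycle of G has an edge between two boundary vertices, and K omits exactly those edges
      K-acyclic : ¬ Cycle K
      K-acyclic C with twoCuttable (subgraph-cycle C)
      ... | i , bᵢ , bₙ with K-edge (edges C i)
      ...   | Ia , Ib , separated =
        contradiction (trans (sym separated) (cong₂ (λ p q → not (p ∧ q)) (boundary-of-bridge Ia bᵢ) (boundary-of-bridge Ib bₙ)))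
                      λ ()

      internals≡ : internals G ≡ nBoundary + nInterior
      internals≡ = count-split I hasLeaf

      R-degree≤2 : ∀ x → degree R x ≤ 2
      R-degree≤2 x = bool-cases (boundary x)
        (λ Tx → subst (degree R x ≤_) (KR-degree-boundary Tx) (m≤n+m _ _))
        (λ ¬Tx → subst (_≤ 2) (sym (R-degree-inner ¬Tx)) z≤n)

      -- handshake in the boundary graph R
      nEnds-even : ∃ λ e → nEnds ≡ e + e
      nEnds-even = halves nEnds y₂ (numE R) (begin
        nEnds + (y₂ + y₂)                                      ≡⟨ cong (nEnds +_) (∑-distrib-+ two two) ⟨
        nEnds + sum (λ x → two x + two x)                      ≡⟨ ∑-distrib-+ one (λ x → two x + two x) ⟨
        sum (λ x → one x + (two x + two x))                 ≡⟨ sum-cong-≗ (λ x → sym (parts (R-degree≤2 x))) ⟩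
        sum (degree R)                                      ≡⟨ handshake R ⟩
        numE R + numE R                                     ∎)
        where
        open ≡-Reasoning
        one two : Fin (n G) → ℕ
        one x = [ degree R x ≡ 1 ]
        two x = [ degree R x ≡ 2 ]
        y₂ = sum two
        parts : ∀ {d} → d ≤ 2 → d ≡ [ d ≡ 1 ] + ([ d ≡ 2 ] + [ d ≡ 2 ])
        parts {0} _ = refl
        parts {1} _ = refl
        parts {2} _ = refl
        parts {suc (suc (suc _))} (s≤s (s≤s ()))

      nEnds≤nBoundary : nEnds ≤ nBoundary
      nEnds≤nBoundary = sum-mono pointwise
        where
        pointwise : ∀ x → [ degree R x ≡ 1 ] ≤ 𝟙 (boundary x)
        pointwise x = bool-cases (boundary x)
          (λ Tx → subst (λ b → [ degree R x ≡ 1 ] ≤ 𝟙 b) (sym Tx) (𝟙≤1 _))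
          (λ ¬Tx → subst₂ (λ d b → [ d ≡ 1 ] ≤ 𝟙 b) (sym (R-degree-inner ¬Tx)) (sym ¬Tx) z≤n)

      -- count the pairs (internal vertex, adjacent leaf) by rows and by columns
      leaves≡nBoundary : leaves G ≡ nBoundary
      leaves≡nBoundary = begin
        leaves G                                        ≡⟨ sum-cong-≗ column ⟨
        sum (λ y → count (λ x → attached x y))          ≡⟨ ∑-comm (λ x y → 𝟙 (attached x y)) ⟨
        sum (λ x → count (attached x))                  ≡⟨ sum-cong-≗ row ⟩
        nBoundary                                               ∎
        where
        open ≡-Reasoning
        attached : Fin (n G) → Fin (n G) → Bool
        attached x y = (I x ∧ adj G x y) ∧ L y

        row : ∀ x → count (attached x) ≡ 𝟙 (boundary x)
        row x = bool-cases (I x)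
          (λ Ix → trans (sum-cong-≗ (λ y → cong (λ i → 𝟙 ((i ∧ adj G x y) ∧ L y)) Ix))
                        (trans (leafNeighbours≡ (internal-degree Ix)) (cong (λ i → 𝟙 (i ∧ hasLeaf x)) (sym Ix))))
          (λ ¬Ix → trans (sum-zero (λ y → cong (λ i → 𝟙 ((i ∧ adj G x y) ∧ L y)) ¬Ix))
                         (cong (λ i → 𝟙 (i ∧ hasLeaf x)) (sym ¬Ix)))

        column : ∀ y → count (λ x → attached x y) ≡ 𝟙 (L y)
        column y = bool-cases (L y) leaf
          (λ ¬Ly → trans (sum-zero (λ x → trans (cong (λ l → 𝟙 ((I x ∧ adj G x y) ∧ l)) ¬Ly)
                                                (cong 𝟙 (Bool.∧-zeroʳ (I x ∧ adj G x y)))))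
                         (cong 𝟙 (sym ¬Ly)))
          where
          leaf : L y ≡ true → count (λ x → attached x y) ≡ 𝟙 (L y)
          leaf Ly = trans (≤-antisym (count≤length (p ∷ []) (λ x e → here (only-p x e))) (count-pos (λ x → attached x y) p-attached))
                          (cong 𝟙 (sym Ly))
            where
            y-leaf = ⌊⌋-sound (degree G y ℕ.≟ 1) Ly
            p-edge = count-witness (adj G y) (subst (1 ≤_) (trans (sym y-leaf) (degree≡count G y)) ≤-refl)
            p = proj₁ p-edge
            py : adj G p y ≡ true
            py = trans (Graph.sym G p y) (proj₂ p-edge)
            p-attached : attached p y ≡ true
            p-attached = cong₂ _∧_ (cong₂ _∧_ (⌊⌋-yes (degree G p ℕ.≟ 3) (leaf-attached-to-internal y-leaf (proj₂ p-edge))) py)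
                                   Ly
            only-p : ∀ x → attached x y ≡ true → x ≡ p
            only-p x e = leaf-neighbour y-leaf (proj₂ p-edge) (trans (Graph.sym G y x) (∧-conicalʳ (I x) _ (∧-conicalˡ _ (L y) e)))

      interior-of : ∀ {x} → I x ≡ true → boundary x ≡ false → interior x ≡ true
      interior-of {x} Ix ¬Tx = cong₂ (λ i h → i ∧ not h) Ix (trans (sym (cong (_∧ hasLeaf x) Ix)) ¬Tx)

      -- both ends of an edge of K are internal, and they are not both on the boundary
      K-edge⇒interior : ∀ {x} → 1 ≤ degree K x → 1 ≤ nInterior
      K-edge⇒interior {x} x-active with count-witness (adj K x) (subst (1 ≤_) (degree≡count K x) x-active)
      ... | y , xy with K-edge xy
      ...   | Ix , Iy , separated = bool-cases (boundary x)
          (λ Tx → bool-cases (boundary y)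
            (λ Ty → contradiction (trans (sym separated) (cong₂ (λ p q → not (p ∧ q)) Tx Ty)) λ ())
            (λ ¬Ty → count-pos interior (interior-of Iy ¬Ty)))
          (λ ¬Tx → count-pos interior (interior-of Ix ¬Tx))

      no-K-edge⇒no-interior : (∀ x → degree K x ≡ 0) → nInterior ≡ 0
      no-K-edge⇒no-interior isolated = n≤0⇒n≡0 (count≤length [] none)
        where
        none : ∀ x → interior x ≡ true → x ∈ []
        none x e = contradiction (trans (sym (K-degree-interior Ix ¬hx)) (isolated x)) λ ()
          where
          Ix = ∧-conicalˡ (I x) _ e
          ¬hx = trans (sym (Bool.not-involutive (hasLeaf x))) (cong not (∧-conicalʳ (I x) _ e))

      two-internal-neighbours : ∀ {x} → degree G x ≡ 3 → 2 ≤ internalNeighbours x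
      two-internal-neighbours {x} deg3 = lower-bound (𝟙≤1 (hasLeaf x)) (internalNeighbours≡ deg3)
        where
        lower-bound : ∀ {a b} → a ≤ 1 → a + b ≡ 3 → 2 ≤ b
        lower-bound {0} _ refl = s≤s (s≤s z≤n)
        lower-bound {1} _ refl = ≤-refl
        lower-bound {suc (suc _)} (s≤s ()) _

      three-internals : 3 ≤ internals G
      three-internals with count-witness I some-internal
      ... | x₀ , Ix₀ with count-witness₂ (λ y → adj G x₀ y ∧ I y) (two-internal-neighbours (internal-degree Ix₀))
      ... | a , b , a≢b , x₀a∧Ia , x₀b∧Ib =
        internals≥ ((x₀≢ x₀a∧Ia ∷ x₀≢ x₀b∧Ib ∷ []) ∷ (a≢b ∷ []) ∷ [] ∷ [])
                   (internal-degree Ix₀ ∷ internal-degree (∧-conicalʳ _ (I a) x₀a∧Ia)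
                                        ∷ internal-degree (∧-conicalʳ _ (I b) x₀b∧Ib) ∷ [])
        where
        x₀≢ : ∀ {z} → adj G x₀ z ∧ I z ≡ true → x₀ ≢ z
        x₀≢ {z} e = adjacent⇒distinct G (∧-conicalˡ _ (I z) e)

      result : internals G + 6 ≤ 3 * leaves G
      result = subst₂ (λ i l → i + 6 ≤ 3 * l) (sym internals≡) (sym leaves≡nBoundary) bound
        where
        bound : nBoundary + nInterior + 6 ≤ 3 * nBoundary
        bound with any? (λ x → 1 ℕ.≤? degree K x)
        ... | yes (x , x-active) = boundary-arith {e = proj₁ nEnds-even} (K-edge⇒interior x-active)
            (forest-arith {A = count (nonIsolated K)} (forest-bound K K-acyclic x-active) sum-identity) nEnds≤nBoundary (proj₂ nEnds-even)
        ... | no no-edge = subst (λ m → nBoundary + m + 6 ≤ 3 * nBoundary) (sym nInterior≡0) (interior-free-arith 3≤nBoundary)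
          where
          nInterior≡0 : nInterior ≡ 0
          nInterior≡0 = no-K-edge⇒no-interior (λ x → n≤0⇒n≡0 (≮⇒≥ (λ x-active → no-edge (x , x-active))))
          3≤nBoundary : 3 ≤ nBoundary
          3≤nBoundary = subst (3 ≤_) (trans internals≡ (trans (cong (nBoundary +_) nInterior≡0) (+-identityʳ _))) three-internals

    leaf-bound : internals G + 6 ≤ 3 * leaves G
    leaf-bound with internals G ℕ.≟ 0
    ... | yes none = no-internals none
    ... | no some with any? (λ w → (degree G w ℕ.≟ 3) ×-dec (2 ℕ.≤? leafNeighbours w))
    ...   | yes (w , deg3 , two) = star deg3 two
    ...   | no no-star = NonStar.result (n≢0⇒n>0 some) (λ deg3 → ≤-pred (≰⇒> (λ two → no-star (_ , deg3 , two))))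


  -- The leaf bound

  split-arith : ∀ {iG iA iB lG lA lB} → iG ≡ iA + iB → lA + lB ≡ lG + 2 →
                iA + 6 ≤ 3 * lA → iB + 6 ≤ 3 * lB → iG + 6 ≤ 3 * lG
  split-arith {iG} {iA} {iB} {lG} {lA} {lB} iG≡ l≡ boundA boundB = +-cancelʳ-≤ 6 (iG + 6) (3 * lG) (begin
    iG + 6 + 6                ≡⟨ cong (λ i → i + 6 + 6) iG≡ ⟩
    iA + iB + 6 + 6           ≡⟨ shuffle iA iB ⟩
    (iA + 6) + (iB + 6)       ≤⟨ +-mono-≤ boundA boundB ⟩
    3 * lA + 3 * lB           ≡⟨ *-distribˡ-+ 3 lA lB ⟨
    3 * (lA + lB)             ≡⟨ cong (3 *_) l≡ ⟩
    3 * (lG + 2)              ≡⟨ *-distribˡ-+ 3 lG 2 ⟩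
    3 * lG + 6                ∎)
    where
    open ≤-Reasoning
    shuffle : ∀ a b → a + b + 6 + 6 ≡ (a + 6) + (b + 6)
    shuffle = solve-∀

  -- classical case distinctions are admissible because the goal is decidable
  decidable-by : ∀ {A B : Set} → Dec B → ¬ ¬ A → (A → B) → B
  decidable-by B? ¬¬a f = decidable-stable B? (λ ¬b → ¬¬a (¬b ∘ f))

  ¬¬-decide-all : ∀ {n} (P : Fin n → Set) → ¬ ¬ (∀ x → Dec (P x))
  ¬¬-decide-all {zero}  P ¬all = ¬all (λ ())
  ¬¬-decide-all {suc n} P ¬all = ¬¬-decide-all (P ∘ suc) (λ rest → ¬¬-excluded-middle (λ first →
    ¬all (λ { zero → first ; (suc x) → rest x })))

  private
    LeafBound : ℕ → Set
    LeafBound k = ∀ G → internals G ≡ k → IsNetwork G → internals G + 6 ≤ 3 * leaves G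

  -- split along a bridge between internal vertices while there is one
  leaf-bound : ∀ G → IsNetwork G → internals G + 6 ≤ 3 * leaves G
  leaf-bound G = <-rec LeafBound induct (internals G) G refl
    where
    induct : ∀ k → (∀ {k′} → k′ < k → LeafBound k′) → LeafBound k
    induct _ smaller G refl N = decidable-by goal? (¬¬-excluded-middle {A = InternalBridge}) λ
      { (no no-bridge) → Base.leaf-bound N (λ du dv uv → no-bridge (_ , _ , du , dv , uv))
      ; (yes (u , v , du , dv , uv)) →
          decidable-by goal? (¬¬-decide-all (Reach (deleteEdge G u v) u)) λ reachᵤ? →
          decidable-by goal? (¬¬-decide-all (Reach (deleteEdge G v u) v)) λ reachᵥ? →
          split N du dv uv reachᵤ? reachᵥ?
      }
      where
      goal? = internals G + 6 ℕ.≤? 3 * leaves G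
      InternalBridge = ∃₂ λ u v → degree G u ≡ 3 × degree G v ≡ 3 × IsBridge G u v
      split : ∀ {u v} → IsNetwork G → degree G u ≡ 3 → degree G v ≡ 3 → IsBridge G u v →
              (∀ x → Dec (Reach (deleteEdge G u v) u x)) → (∀ x → Dec (Reach (deleteEdge G v u) v x)) →
              internals G + 6 ≤ 3 * leaves G
      split N du dv uv reachᵤ? reachᵥ? =
        split-arith {lA = leaves A-side} {lB = leaves B-side} internals-split leaves-split
          (smaller A-smaller A-side refl A.side-isNetwork) (smaller B-smaller B-side refl B.side-isNetwork)
        where
        open Split N du dv uv reachᵤ? reachᵥ?
        A-smaller : internals A-side < internals G
        A-smaller = subst (internals A-side <_) (sym internals-split) (m<m+n _ B-internal)
        B-smaller : internals B-side < internals G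
        B-smaller = subst (internals B-side <_) (trans (+-comm (internals B-side) _) (sym internals-split)) (m<m+n _ A-internal)


  -- Phylogenetic networks

  -- doubling: 2E = L + 3I and 2V = 2L + 2I, so it remains to show I + 4 ≤ L + 2m
  edge-arith : ∀ {E V L I m} → E + E ≡ L + (I + (I + I)) → V ≡ L + I → I + 6 ≤ 3 * L → L ≤ m → E + 2 ≤ V + m
  edge-arith {E} {V} {L} {I} {m} E+E≡ V≡ I+6≤3L L≤m = *-cancelˡ-≤ 2 (begin
    2 * (E + 2)                    ≡⟨ double-edges E ⟩
    (E + E) + 4                    ≡⟨ cong (_+ 4) E+E≡ ⟩
    L + (I + (I + I)) + 4          ≡⟨ regroup L I ⟩
    (L + (I + I)) + (I + 4)        ≤⟨ +-monoʳ-≤ (L + (I + I)) I+4≤ ⟩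
    (L + (I + I)) + (L + (m + m))  ≡⟨ double-vertices L I m ⟨
    2 * (L + I + m)                ≡⟨ cong (λ v → 2 * (v + m)) V≡ ⟨
    2 * (V + m)                    ∎)
    where
    open ≤-Reasoning
    double-edges : ∀ E → 2 * (E + 2) ≡ (E + E) + 4
    double-edges = solve-∀
    regroup : ∀ L I → L + (I + (I + I)) + 4 ≡ (L + (I + I)) + (I + 4)
    regroup = solve-∀
    double-vertices : ∀ L I m → 2 * (L + I + m) ≡ (L + (I + I)) + (L + (m + m))
    double-vertices = solve-∀
    triple : ∀ L → 3 * L ≡ L + (L + L)
    triple = solve-∀
    I+4≤ : I + 4 ≤ L + (m + m)
    I+4≤ = begin
      I + 4          ≤⟨ +-monoʳ-≤ I (m≤m+n 4 2) ⟩
      I + 6          ≤⟨ I+6≤3L ⟩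
      3 * L          ≡⟨ triple L ⟩
      L + (L + L)    ≤⟨ +-monoʳ-≤ L (+-mono-≤ L≤m L≤m) ⟩
      L + (m + m)    ∎

  module _ {m : ℕ} (U : UBPN m) where

    private
      G = graph U

    degree-1-3 : ∀ x → degree G x ≡ 1 ⊎ degree G x ≡ 3
    degree-1-3 x with degree G x ℕ.≟ 1
    ... | yes deg1 = inj₁ deg1
    ... | no ¬deg1 = inj₂ (internal U x ¬deg1)

    network : TwoCuttable G → IsNetwork G
    network tc = record
      { degree-0-1-3 = inj₂ ∘ degree-1-3
      ; reach        = λ {x} {y} _ _ → connected U x y
      ; twoCuttable  = map₂ (Product.map bridge bridge) ∘ tc
      ; hasEdge      = label U x₀ , subst (1 ≤_) (sym (labelLeaf U x₀)) ≤-refl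
      }
      where
      x₀ = fromℕ< (nonEmpty U)
      bridge : ∀ {x} → IncidentToCutEdge G x → IncidentToBridge G x
      bridge (y , cut) = y , cutEdge⇒bridge {G} (connected U) cut

    leaves≤m : leaves G ≤ m
    leaves≤m = subst (leaves G ≤_) (length-tabulate (label U)) (count≤length (tabulate (label U)) labelled)
      where
      labelled : ∀ x → isLeaf G x ≡ true → x ∈ tabulate (label U)
      labelled x leaf with labelSurj U x (⌊⌋-sound (degree G x ℕ.≟ 1) leaf)
      ... | i , refl = ∈-tabulate⁺ i

    vertices≡ : numV G ≡ leaves G + internals G
    vertices≡ = trans (sym (count-true (n G)))
                      (trans (sum-cong-≗ pointwise) (∑-distrib-+ (𝟙 ∘ isLeaf G) (𝟙 ∘ isInternal G)))
      where
      pointwise : ∀ x → 1 ≡ [ degree G x ≡ 1 ] + [ degree G x ≡ 3 ]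
      pointwise x with degree-1-3 x
      ... | inj₁ deg1 rewrite deg1 = refl
      ... | inj₂ deg3 rewrite deg3 = refl

    edges≡ : numE G + numE G ≡ leaves G + (internals G + (internals G + internals G))
    edges≡ = begin
      numE G + numE G                                      ≡⟨ handshake G ⟨
      sum (degree G)                                       ≡⟨ sum-cong-≗ pointwise ⟩
      sum (λ x → one x + (three x + (three x + three x)))  ≡⟨ ∑-distrib-+ one (λ x → three x + (three x + three x)) ⟩
      leaves G + sum (λ x → three x + (three x + three x))
        ≡⟨ cong (leaves G +_) (trans (∑-distrib-+ three (λ x → three x + three x))
                                     (cong (internals G +_) (∑-distrib-+ three three))) ⟩
      leaves G + (internals G + (internals G + internals G)) ∎
      where
      open ≡-Reasoning
      one three : Fin (n G) → ℕ
      one x   = [ degree G x ≡ 1 ]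
      three x = [ degree G x ≡ 3 ]
      pointwise : ∀ x → degree G x ≡ one x + (three x + (three x + three x))
      pointwise x with degree-1-3 x
      ... | inj₁ deg1 rewrite deg1 = refl
      ... | inj₂ deg3 rewrite deg3 = refl

    vertices-pos : 1 ≤ numV G
    vertices-pos = ≤-trans (nonEmpty U) (injective⇒≤ (labelInj U))

    edges+2≤vertices+m : TwoCuttable G → numE G + 2 ≤ numV G + m
    edges+2≤vertices+m tc = edge-arith edges≡ vertices≡ (leaf-bound G (network tc)) leaves≤m

open import Data.Integer using (_≤_; _-_; +_; _⊖_)
open import Data.Integer.Properties using (m-n≡m⊖n; ⊖-monoˡ-≤; ⊖-≥; module ≤-Reasoning)
import Data.Nat as ℕ
open import Data.Nat.Properties using (≤-pred; +-comm; +-suc; m≤m+n; m+n∸m≡n)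
open import Relation.Binary.PropositionalEquality using (cong; subst₂)

reticulation-bound : ∀ {E V m} → 1 ℕ.≤ V → 1 ℕ.≤ m → E ℕ.+ 2 ℕ.≤ V ℕ.+ m → + E - (+ V - + 1) ≤ + m - + 1
-- + suc k - + 1 reduces to + k, so the goal is + E - + V ≤ + m
reticulation-bound {E} {ℕ.suc V} {ℕ.suc m} _ _ E+2≤V+m = begin
  + E - + V            ≡⟨ m-n≡m⊖n E V ⟩
  E ⊖ V                ≤⟨ ⊖-monoˡ-≤ V E≤V+m ⟩
  (V ℕ.+ m) ⊖ V        ≡⟨ ⊖-≥ (m≤m+n V m) ⟩
  + (V ℕ.+ m ℕ.∸ V)    ≡⟨ cong +_ (m+n∸m≡n V m) ⟩
  + m                  ∎
  where
  open ≤-Reasoning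
  E≤V+m : E ℕ.≤ V ℕ.+ m
  E≤V+m = ≤-pred (≤-pred (subst₂ ℕ._≤_ (+-comm E 2) (cong ℕ.suc (+-suc V m)) E+2≤V+m))

corollary2 : (m : ℕ) (U : UBPN m) → TwoCuttable (graph U) →
    reticulationNumber (graph U) ≤ + m - + 1
corollary2 m U tc = reticulation-bound (vertices-pos U) (nonEmpty U) (edges+2≤vertices+m U tc)
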